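{- Let $F$ be a finite field and $q=|F|$. Let $k,n\in\mathbb{N}$ satisfy $k\leq n$. Fix any $k$-tuple $a=(a_0,a_1,\ldots,a_{k-1})\in F^k$. Then the number of $(2n+1)$-tuples $x\in F^{2n+1}$ satisfying $x_{[0,k)}=a$ and $\det(H_{n,n}(x))=0$ is $q^{2n-k}$.
   Context: $\mathbb{N}=\{0,1,2,\ldots\}$. For $x=(x_0,x_1,\ldots,x_{2n})\in F^{2n+1}$, $H_{n,n}(x)$ is the $(n+1)\times(n+1)$ Hankel matrix $(x_{i+j})_{0\leq i\leq n,\ 0\leq j\leq n}$. For a tuple $x=(x_0,\ldots,x_N)$ and $i\in\{0,\ldots,N+1\}$, $x_{[0,i)}$ denotes $(x_0,x_1,\ldots,x_{i-1})$. -}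

module Defs where

open import Level using (0ℓ)
open import Algebra.Bundles using (CommutativeRing)
import Data.Nat as ℕ
open import Data.Nat using (ℕ; zero; suc; _≤_; _<_; s≤s)
open import Data.Nat.Properties using (+-mono-≤; ≤-trans; m≤n⇒m≤1+n; +-identityʳ)
open import Data.Fin using (Fin; zero; suc; toℕ; fromℕ<; inject≤; punchIn)
open import Data.Fin.Properties using (toℕ≤pred[n]; all?)
open import Data.List using (List; []; _∷_; allFin; map; concatMap; length; filter)
open import Data.List using () renaming ([_] to [_]ₗ)
open import Data.Vec.Functional using (Vector) renaming (_∷_ to _∷ᵥ_)
open import Data.Product using (∃; _,_)
open import Relation.Nullary using (¬_; Dec; _×-dec_)
open import Relation.Unary using (Pred; Decidable)
open import Relation.Binary.PropositionalEquality using (_≡_; subst; sym)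
open import Data.Nat using (_≤?_)

allFuns : (m q : ℕ) → List (Fin m → Fin q)
allFuns zero    q = [ (λ ()) ]ₗ
allFuns (suc m) q = concatMap (λ i → map (λ f → i ∷ᵥ f) (allFuns m q)) (allFin q)

record FiniteField : Set₁ where
  field
    commRing : CommutativeRing 0ℓ 0ℓ
  open CommutativeRing commRing public
  field
    0≉1      : ¬ (0# ≈ 1#)
    inverse  : ∀ x → ¬ (x ≈ 0#) → ∃ λ y → x * y ≈ 1#
    _≈?_     : ∀ x y → Dec (x ≈ y)
    size     : ℕ
    enum     : Fin size → Carrier
    enum-inj : ∀ i j → enum i ≈ enum j → i ≡ j
    enum-sur : ∀ x → ∃ λ i → enum i ≈ x

module _ (F : FiniteField) where
  open FiniteField F using (Carrier; _≈_; _≈?_; _+_; _*_; -_; 0#; 1#; size; enum)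

  Matrix : ℕ → Set
  Matrix m = Fin m → Fin m → Carrier

  sumF : ∀ {m} → (Fin m → Carrier) → Carrier
  sumF {zero}  f = 0#
  sumF {suc m} f = f zero + sumF (λ i → f (suc i))

  sign : ℕ → Carrier
  sign zero    = 1#
  sign (suc j) = - sign j

  det : ∀ m → Matrix m → Carrier
  det zero    M = 1#
  det (suc m) M =
    sumF (λ j → sign (toℕ j) * (M zero j * det m (λ r c → M (suc r) (punchIn j c))))

  hankelIdx : ∀ n → Fin (suc n) → Fin (suc n) → Fin (suc (2 ℕ.* n))
  hankelIdx n i j = fromℕ< (s≤s bound)
    where
      bound : toℕ i ℕ.+ toℕ j ≤ 2 ℕ.* n
      bound = subst (λ t → toℕ i ℕ.+ toℕ j ≤ n ℕ.+ t) (sym (+-identityʳ n))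
                (+-mono-≤ (toℕ≤pred[n] i) (toℕ≤pred[n] j))

  hankel : ∀ n → Vector Carrier (suc (2 ℕ.* n)) → Matrix (suc n)
  hankel n x i j = x (hankelIdx n i j)

  k≤2n+1 : ∀ {k n} → k ≤ n → k ≤ suc (2 ℕ.* n)
  k≤2n+1 {k} {n} k≤n = m≤n⇒m≤1+n (≤-trans k≤n (m≤m+n' n (n ℕ.+ 0)))
    where
      open import Data.Nat.Properties using () renaming (m≤m+n to m≤m+n')

  PrefixIs : ∀ {k n} → k ≤ n → Vector Carrier k → Vector Carrier (suc (2 ℕ.* n)) → Set
  PrefixIs {k} k≤n a x = ∀ (i : Fin k) → x (inject≤ i (k≤2n+1 k≤n)) ≈ a i

  Good : ∀ {k n} → k ≤ n → Vector Carrier k → Vector Carrier (suc (2 ℕ.* n)) → Set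
  Good {n = n} k≤n a x = PrefixIs k≤n a x Data.Product.× (det (suc n) (hankel n x) ≈ 0#)
    where import Data.Product

  good? : ∀ {k n} (k≤n : k ≤ n) (a : Vector Carrier k) x → Dec (Good k≤n a x)
  good? {n = n} k≤n a x =
    all? (λ i → x (inject≤ i (k≤2n+1 k≤n)) ≈? a i) ×-dec (det (suc n) (hankel n x) ≈? 0#)

  countGood : ∀ {k n} → k ≤ n → Vector Carrier k → ℕ
  countGood {n = n} k≤n a =
    length (filter (λ c → good? k≤n a (λ t → enum (c t))) (allFuns (suc (2 ℕ.* n)) size))

-- Let x₀ = … = x_{j−1} = 0 with x_j invertible, and let u be the power series inverse of
-- g = x_j + x_{j+1} z + x_{j+2} z² + ….  Multiplying H_{n,n}(x) on the right by the upper
-- triangular Toeplitz matrix (u_{c−b}) turns its first j+1 rows into reversed unit vectors,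
-- and its remaining block is, after transposition, H_{m,m}(y) times a triangular Toeplitz
-- matrix with diagonal −x_j, where m = n−j−1 and y_t = u_{j+2+t}.  So det H_{n,n}(x) is a unit
-- multiple of det H_{m,m}(y), and det H_{j,j}(x) is a unit.
-- Over F, let x_j be the first nonzero entry of the prefix a.  The coefficients of u beyond
-- the prefix are affine in the free coordinates, triangularly with diagonal −x_j⁻², so they
-- run over all values exactly once; counting singular extensions of a for H_n thus becomes
-- counting singular extensions of a shorter prefix for H_m, and induction on n applies.
-- If the prefix vanishes, extend it coordinate by coordinate; at length n the next entry
-- decides: 0 makes the first row of H_{n,n} vanish, anything else makes the determinant a
-- unit, so exactly q^n of the q^{n+1} extensions are singular.
module Submission where

open import Level using (_⊔_) renaming (zero to ℓ₀)
open import Algebra.Bundles using (CommutativeMonoid; CommutativeRing; Semiring)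
open import Data.Bool using (true; false; if_then_else_)
open import Data.Empty using (⊥-elim)
open import Data.Fin using (Fin; zero; suc; toℕ; fromℕ<; inject≤; punchIn; punchOut; _↑ʳ_)
import Data.Fin.Properties as Fin
open import Data.List using (List; []; _∷_; _++_; map; length; filter; concatMap; tabulate; allFin)
import Data.List.Properties as List
open import Data.Nat using (ℕ; zero; suc; z≤n; s≤s; _<_; _≤_; _∸_; _<?_; _≤?_)
import Data.Nat as ℕ using (_+_; _*_; _^_; pred; >-nonZero)
open import Data.Nat.Induction using (<-rec)
import Data.Nat.Properties as ℕ
open import Data.Nat.Tactic.RingSolver using (solve-∀)
open import Data.Product using (∃; _×_; _,_; proj₁; proj₂)
open import Data.Sum using (_⊎_; inj₁; inj₂)
open import Data.Vec.Functional using (Vector; removeAt; updateAt; transpose) renaming (_∷_ to _∷ᵥ_)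
open import Data.Vec.Functional.Properties using (updateAt-updates; updateAt-minimal; updateAt-id-local)
open import Function using (const)
open import Relation.Nullary using (¬_; Dec; yes; no; does)
open import Relation.Nullary.Decidable using (_×-dec_)
open import Relation.Unary using (Pred; Decidable; _≐_)
open import Relation.Binary.Definitions using (tri<; tri≈; tri>)
open import Relation.Binary.PropositionalEquality as ≡ using (_≡_; _≢_)
open import Defs using (FiniteField; allFuns; countGood)
import Defs

toℕ-punchIn-< : ∀ {m} (j : Fin (suc m)) (k : Fin m) → toℕ k < toℕ j → toℕ (punchIn j k) ≡ toℕ k
toℕ-punchIn-< zero    k       ()
toℕ-punchIn-< (suc j) zero    _       = ≡.refl
toℕ-punchIn-< (suc j) (suc k) (s≤s k<j) = ≡.cong suc (toℕ-punchIn-< j k k<j)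

toℕ-punchIn-≥ : ∀ {m} (j : Fin (suc m)) (k : Fin m) → toℕ j ≤ toℕ k → toℕ (punchIn j k) ≡ suc (toℕ k)
toℕ-punchIn-≥ zero    k       _         = ≡.refl
toℕ-punchIn-≥ (suc j) (suc k) (s≤s j≤k) = ≡.cong suc (toℕ-punchIn-≥ j k j≤k)

m<n⇒n≡1+[n∸1+m]+m : ∀ {m n} → m < n → n ≡ suc (n ∸ suc m ℕ.+ m)
m<n⇒n≡1+[n∸1+m]+m {m} {n} m<n = ≡.trans (≡.sym (ℕ.m∸n+n≡m m<n)) (ℕ.+-suc (n ∸ suc m) m)

module CommutativeMonoidSum {a ℓ} (M : CommutativeMonoid a ℓ) where
  open CommutativeMonoid M
    renaming (_∙_ to _+_; ε to 0#; ∙-cong to +-cong; ∙-congˡ to +-congˡ; assoc to +-assoc;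
              identityˡ to +-identityˡ; identityʳ to +-identityʳ)
  open import Algebra.Properties.CommutativeMonoid.Sum M
  open import Relation.Binary.Reasoning.Setoid setoid

  sum-zero : ∀ {n} {f : Fin n → Carrier} → (∀ i → f i ≈ 0#) → sum f ≈ 0#
  sum-zero {n} f≈0 = trans (sum-cong-≋ f≈0) (sum-replicate-zero n)

  sum-single : ∀ {n} {f : Fin n → Carrier} i → (∀ j → j ≢ i → f j ≈ 0#) → sum f ≈ f i
  sum-single {suc n} {f} i others = begin
    sum f                     ≈⟨ sum-remove f ⟩
    f i + sum (removeAt f i)  ≈⟨ +-congˡ (sum-zero λ j → others _ (Fin.punchInᵢ≢i i j)) ⟩
    f i + 0#                  ≈⟨ +-identityʳ _ ⟩
    f i                       ∎

  sum-adjacent-cancel : ∀ {n} (f : Fin n → Carrier) (k : ℕ) → suc k < n →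
    (∀ j → toℕ j ≢ k → toℕ j ≢ suc k → f j ≈ 0#) →
    (∀ j j′ → toℕ j ≡ k → toℕ j′ ≡ suc k → f j + f j′ ≈ 0#) → sum f ≈ 0#
  sum-adjacent-cancel {suc (suc n)} f zero _ others pair = begin
    f zero + (f (suc zero) + sum (λ i → f (suc (suc i)))) ≈⟨ +-assoc _ _ _ ⟨
    (f zero + f (suc zero)) + sum (λ i → f (suc (suc i)))
      ≈⟨ +-cong (pair zero (suc zero) ≡.refl ≡.refl) (sum-zero λ i → others (suc (suc i)) (λ ()) (λ ())) ⟩
    0# + 0#                                              ≈⟨ +-identityˡ 0# ⟩
    0#                                                   ∎
  sum-adjacent-cancel {suc n} f (suc k) (s≤s lt) others pair =
    trans (+-cong (others zero (λ ()) (λ ()))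
                  (sum-adjacent-cancel (λ i → f (suc i)) k lt
                    (λ j j≢k j≢1+k → others (suc j) (λ e → j≢k (ℕ.suc-injective e)) (λ e → j≢1+k (ℕ.suc-injective e)))
                    (λ j j′ e e′ → pair (suc j) (suc j′) (≡.cong suc e) (≡.cong suc e′))))
          (+-identityˡ 0#)

module Determinant {ℓ₁ ℓ₂} (R : CommutativeRing ℓ₁ ℓ₂) where
  open CommutativeRing R hiding (zero)
  open import Algebra.Properties.Ring ring
  open import Algebra.Properties.Semiring.Sum semiring
  open CommutativeMonoidSum +-commutativeMonoid
  open import Algebra.Definitions.RawSemiring (Semiring.rawSemiring semiring) using (_^_)
  open import Algebra.Solver.CommutativeMonoid *-commutativeMonoid using (solve; _⊕_; _⊜_)
  open import Relation.Binary.Reasoning.Setoid setoid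

  Matrix : ℕ → Set ℓ₁
  Matrix m = Fin m → Fin m → Carrier

  sign : ℕ → Carrier
  sign zero    = 1#
  sign (suc j) = - sign j

  minor : ∀ {m} → Fin (suc m) → Matrix (suc m) → Matrix m
  minor j M r k = M (suc r) (punchIn j k)

  det : ∀ m → Matrix m → Carrier
  det zero    M = 1#
  det (suc m) M = ∑[ j < suc m ] (sign (toℕ j) * (M zero j * det m (minor j M)))

  det-cong : ∀ m {M N : Matrix m} → (∀ i j → M i j ≈ N i j) → det m M ≈ det m N
  det-cong zero    M≈N = refl
  det-cong (suc m) M≈N = sum-cong-≋ λ j →
    *-congˡ {sign (toℕ j)} (*-cong (M≈N zero j) (det-cong m λ r k → M≈N (suc r) (punchIn j k)))

  det-zero-first-row : ∀ m (M : Matrix (suc m)) → (∀ j → M zero j ≈ 0#) → det (suc m) M ≈ 0#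
  det-zero-first-row m M row≈0 = sum-zero λ j → begin
    sign (toℕ j) * (M zero j * det m (minor j M)) ≈⟨ *-congˡ (*-congʳ (row≈0 j)) ⟩
    sign (toℕ j) * (0# * det m (minor j M))       ≈⟨ *-congˡ (zeroˡ _) ⟩
    sign (toℕ j) * 0#                             ≈⟨ zeroʳ _ ⟩
    0#                                            ∎

  AgreeOffColumn : ∀ {m} → Fin m → Matrix m → Matrix m → Set ℓ₂
  AgreeOffColumn k A B = ∀ r j → j ≢ k → A r j ≈ B r j

  det-linear-column : ∀ m (k : Fin m) (l : Carrier) (A B C : Matrix m) →
    AgreeOffColumn k A C → AgreeOffColumn k B C → (∀ r → C r k ≈ l * A r k + B r k) →
    det m C ≈ l * det m A + det m B
  det-linear-column (suc m) k l A B C A∼C B∼C Cₖ = begin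
    sum (term C)                               ≈⟨ sum-cong-≋ term-linear ⟩
    sum (λ j → l * term A j + term B j)        ≈⟨ ∑-distrib-+ (λ j → l * term A j) (term B) ⟩
    sum (λ j → l * term A j) + sum (term B)    ≈⟨ +-congʳ (*-distribˡ-sum l (term A)) ⟨
    l * sum (term A) + sum (term B)            ∎
    where
    term : Matrix (suc m) → Fin (suc m) → Carrier
    term M j = sign (toℕ j) * (M zero j * det m (minor j M))
    term-linear : ∀ j → term C j ≈ l * term A j + term B j
    term-linear j with j Fin.≟ k
    ... | yes ≡.refl = begin
      s * (C zero j * det m (minor j C))                  ≈⟨ *-congˡ (*-congʳ (Cₖ zero)) ⟩
      s * ((l * A zero j + B zero j) * det m (minor j C)) ≈⟨ expand (A zero j) (B zero j) (det m (minor j C)) ⟩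
      l * (s * (A zero j * det m (minor j C))) + s * (B zero j * det m (minor j C))
        ≈⟨ +-cong (*-congˡ (*-congˡ (*-congˡ (det-cong m λ r i → sym (A∼C (suc r) _ (Fin.punchInᵢ≢i j i))))))
                  (*-congˡ (*-congˡ (det-cong m λ r i → sym (B∼C (suc r) _ (Fin.punchInᵢ≢i j i))))) ⟩
      l * term A j + term B j                             ∎
      where
      s = sign (toℕ j)
      expand : ∀ a b d → s * ((l * a + b) * d) ≈ l * (s * (a * d)) + s * (b * d)
      expand a b d = trans (*-congˡ (distribʳ d (l * a) b)) (trans (distribˡ s _ _)
        (+-congʳ (solve 4 (λ s l a d → s ⊕ ((l ⊕ a) ⊕ d) ⊜ l ⊕ (s ⊕ (a ⊕ d))) refl s l a d)))
    ... | no j≢k = begin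
      s * (C zero j * det m (minor j C))
        ≈⟨ *-congˡ (*-congˡ (det-linear-column m k′ l (minor j A) (minor j B) (minor j C)
             (λ r i i≢k′ → A∼C (suc r) _ (λ e → i≢k′ (punchIn≡k e)))
             (λ r i i≢k′ → B∼C (suc r) _ (λ e → i≢k′ (punchIn≡k e)))
             (λ r → ≡.subst (λ z → C (suc r) z ≈ l * A (suc r) z + B (suc r) z)
                            (≡.sym (Fin.punchIn-punchOut j≢k)) (Cₖ (suc r))))) ⟩
      s * (C zero j * (l * det m (minor j A) + det m (minor j B)))
        ≈⟨ expand (C zero j) (det m (minor j A)) (det m (minor j B)) ⟩
      l * (s * (C zero j * det m (minor j A))) + s * (C zero j * det m (minor j B))
        ≈⟨ +-cong (*-congˡ (*-congˡ (*-congʳ (sym (A∼C zero j j≢k))))) (*-congˡ (*-congʳ (sym (B∼C zero j j≢k)))) ⟩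
      l * term A j + term B j ∎
      where
      s = sign (toℕ j)
      k′ = punchOut j≢k
      punchIn≡k : ∀ {i} → punchIn j i ≡ k → i ≡ k′
      punchIn≡k {i} e = Fin.punchIn-injective j i k′ (≡.trans e (≡.sym (Fin.punchIn-punchOut j≢k)))
      expand : ∀ a x y → s * (a * (l * x + y)) ≈ l * (s * (a * x)) + s * (a * y)
      expand a x y = trans (*-congˡ (distribˡ a (l * x) y)) (trans (distribˡ s _ _)
        (+-congʳ (solve 4 (λ s l a x → s ⊕ (a ⊕ (l ⊕ x)) ⊜ l ⊕ (s ⊕ (a ⊕ x))) refl s l a x)))

  minor-adjacent : ∀ {m} (M : Matrix (suc m)) k (j j′ : Fin (suc m)) → toℕ j ≡ k → toℕ j′ ≡ suc k →
    (∀ r i i′ → toℕ i ≡ k → toℕ i′ ≡ suc k → M r i ≈ M r i′) → ∀ r i → minor j′ M r i ≈ minor j M r i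
  minor-adjacent M k j j′ e e′ cols r i with ℕ.<-cmp (toℕ i) k
  ... | tri< i<k _ _ = reflexive (≡.cong (M (suc r)) (Fin.toℕ-injective (≡.trans
          (toℕ-punchIn-< j′ i (≡.subst (toℕ i <_) (≡.sym e′) (ℕ.m<n⇒m<1+n i<k)))
          (≡.sym (toℕ-punchIn-< j i (≡.subst (toℕ i <_) (≡.sym e) i<k))))))
  ... | tri≈ _ i≡k _ = cols (suc r) _ _
          (≡.trans (toℕ-punchIn-< j′ i (≡.subst (toℕ i <_) (≡.sym e′) (≡.subst (_< suc k) (≡.sym i≡k) (ℕ.n<1+n k)))) i≡k)
          (≡.trans (toℕ-punchIn-≥ j i (≡.subst (_≤ toℕ i) (≡.sym e) (ℕ.≤-reflexive (≡.sym i≡k)))) (≡.cong suc i≡k))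
  ... | tri> _ _ k<i = reflexive (≡.cong (M (suc r)) (Fin.toℕ-injective (≡.trans
          (toℕ-punchIn-≥ j′ i (≡.subst (_≤ toℕ i) (≡.sym e′) k<i))
          (≡.sym (toℕ-punchIn-≥ j i (≡.subst (_≤ toℕ i) (≡.sym e) (ℕ.<⇒≤ k<i)))))))

  det-adjacent-equal-columns : ∀ m (M : Matrix m) (k : ℕ) → suc k < m →
    (∀ r i i′ → toℕ i ≡ k → toℕ i′ ≡ suc k → M r i ≈ M r i′) → det m M ≈ 0#
  det-adjacent-equal-columns (suc m) M k 1+k<1+m cols = sum-adjacent-cancel term k 1+k<1+m vanishing cancelling
    where
    term : Fin (suc m) → Carrier
    term j = sign (toℕ j) * (M zero j * det m (minor j M))

    minor-vanishing : ∀ j k′ → suc k′ < m →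
      (∀ i → toℕ i ≡ k′ → toℕ (punchIn j i) ≡ k) → (∀ i → toℕ i ≡ suc k′ → toℕ (punchIn j i) ≡ suc k) →
      term j ≈ 0#
    minor-vanishing j k′ lt p p′ = begin
      sign (toℕ j) * (M zero j * det m (minor j M))
        ≈⟨ *-congˡ (*-congˡ (det-adjacent-equal-columns m (minor j M) k′ lt
             λ r i i′ e e′ → cols (suc r) _ _ (p i e) (p′ i′ e′))) ⟩
      sign (toℕ j) * (M zero j * 0#) ≈⟨ *-congˡ (zeroʳ _) ⟩
      sign (toℕ j) * 0#              ≈⟨ zeroʳ _ ⟩
      0#                             ∎

    vanishing : ∀ j → toℕ j ≢ k → toℕ j ≢ suc k → term j ≈ 0#
    vanishing j j≢k j≢1+k with ℕ.<-cmp (toℕ j) k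
    ... | tri≈ _ e _ = ⊥-elim (j≢k e)
    ... | tri> _ _ k<j = minor-vanishing j k 1+k<m
            (λ i e → ≡.trans (toℕ-punchIn-< j i (≡.subst (_< toℕ j) (≡.sym e) k<j)) e)
            (λ i e → ≡.trans (toℕ-punchIn-< j i (≡.subst (_< toℕ j) (≡.sym e) 1+k<j)) e)
      where
      1+k<j : suc k < toℕ j
      1+k<j = ℕ.≤∧≢⇒< k<j (λ e → j≢1+k (≡.sym e))
      1+k<m : suc k < m
      1+k<m = ℕ.<-≤-trans 1+k<j (ℕ.≤-pred (Fin.toℕ<n j))
    ... | tri< j<k _ _ = minor-vanishing j (ℕ.pred k) 1+k′<m
            (λ i e → ≡.trans (toℕ-punchIn-≥ j i (≡.subst (toℕ j ≤_) (≡.sym e) j≤k′)) (≡.trans (≡.cong suc e) 1+k′≡k))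
            (λ i e → ≡.trans (toℕ-punchIn-≥ j i (≡.subst (toℕ j ≤_) (≡.sym e) (ℕ.m≤n⇒m≤1+n j≤k′))) (≡.cong suc (≡.trans e 1+k′≡k)))
      where
      1+k′≡k : suc (ℕ.pred k) ≡ k
      1+k′≡k = ℕ.suc-pred k ⦃ ℕ.>-nonZero (ℕ.≤-trans (s≤s z≤n) j<k) ⦄
      j≤k′ : toℕ j ≤ ℕ.pred k
      j≤k′ = ℕ.≤-pred (≡.subst (suc (toℕ j) ≤_) (≡.sym 1+k′≡k) j<k)
      1+k′<m : suc (ℕ.pred k) < m
      1+k′<m = ≡.subst (_< m) (≡.sym 1+k′≡k) (ℕ.≤-pred 1+k<1+m)

    cancelling : ∀ j j′ → toℕ j ≡ k → toℕ j′ ≡ suc k → term j + term j′ ≈ 0#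
    cancelling j j′ e e′ = begin
      term j + sign (toℕ j′) * (M zero j′ * det m (minor j′ M))
        ≈⟨ +-congˡ (*-cong (reflexive (≡.cong sign e′)) (*-cong (sym (cols zero j j′ e e′)) (det-cong m (minor-adjacent M k j j′ e e′ cols)))) ⟩
      term j + (- sign k) * (M zero j * det m (minor j M))
        ≈⟨ +-cong (*-congʳ (reflexive (≡.cong sign e))) (sym (-‿distribˡ-* _ _)) ⟩
      sign k * (M zero j * det m (minor j M)) + - (sign k * (M zero j * det m (minor j M)))
        ≈⟨ -‿inverseʳ _ ⟩
      0# ∎

  column : ∀ {m} → Matrix m → Fin m → Fin m → Carrier
  column M k r = M r k

  withColumns : ∀ {m} → Matrix m → (i i′ : Fin m) → (X Y : Fin m → Carrier) → Matrix m
  withColumns M i i′ X Y r k with k Fin.≟ i | k Fin.≟ i′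
  ... | yes _ | _     = X r
  ... | no _  | yes _ = Y r
  ... | no _  | no _  = M r k

  swapColumns : ∀ {m} → Matrix m → (i i′ : Fin m) → Matrix m
  swapColumns M i i′ = withColumns M i i′ (column M i′) (column M i)

  module _ {m} (M : Matrix m) (i i′ : Fin m) where

    withColumns-first : ∀ X Y r → withColumns M i i′ X Y r i ≡ X r
    withColumns-first X Y r with i Fin.≟ i
    ... | yes _  = ≡.refl
    ... | no i≢i = ⊥-elim (i≢i ≡.refl)

    withColumns-second : i′ ≢ i → ∀ X Y r → withColumns M i i′ X Y r i′ ≡ Y r
    withColumns-second i′≢i X Y r with i′ Fin.≟ i | i′ Fin.≟ i′
    ... | yes e | _     = ⊥-elim (i′≢i e)
    ... | no _  | yes _ = ≡.refl
    ... | no _  | no ne = ⊥-elim (ne ≡.refl)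

    withColumns-other : ∀ X Y r k → k ≢ i → k ≢ i′ → withColumns M i i′ X Y r k ≡ M r k
    withColumns-other X Y r k k≢i k≢i′ with k Fin.≟ i | k Fin.≟ i′
    ... | yes e | _     = ⊥-elim (k≢i e)
    ... | no _  | yes e = ⊥-elim (k≢i′ e)
    ... | no _  | no _  = ≡.refl

    withColumns-agree-first : ∀ X X′ Y → AgreeOffColumn i (withColumns M i i′ X Y) (withColumns M i i′ X′ Y)
    withColumns-agree-first X X′ Y r k k≢i with k Fin.≟ i | k Fin.≟ i′
    ... | yes e | _     = ⊥-elim (k≢i e)
    ... | no _  | yes _ = refl
    ... | no _  | no _  = refl

    withColumns-agree-second : ∀ X Y Y′ → AgreeOffColumn i′ (withColumns M i i′ X Y) (withColumns M i i′ X Y′)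
    withColumns-agree-second X Y Y′ r k k≢i′ with k Fin.≟ i | k Fin.≟ i′
    ... | yes _ | _     = refl
    ... | no _  | yes e = ⊥-elim (k≢i′ e)
    ... | no _  | no _  = refl

    withColumns-own : (∀ r k → withColumns M i i′ (column M i) (column M i′) r k ≈ M r k)
    withColumns-own r k with k Fin.≟ i | k Fin.≟ i′
    ... | yes ≡.refl | _          = refl
    ... | no _       | yes ≡.refl = refl
    ... | no _       | no _       = refl

  det-additive-column : ∀ m (k : Fin m) (A B C : Matrix m) →
    AgreeOffColumn k A C → AgreeOffColumn k B C → (∀ r → C r k ≈ A r k + B r k) →
    det m C ≈ det m A + det m B
  det-additive-column m k A B C A∼C B∼C Cₖ =
    trans (det-linear-column m k 1# A B C A∼C B∼C (λ r → trans (Cₖ r) (+-congʳ (sym (*-identityˡ _)))))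
          (+-congʳ (*-identityˡ _))

  det-swap-adjacent-columns : ∀ m (M : Matrix m) (i i′ : Fin m) → toℕ i′ ≡ suc (toℕ i) →
    det m (swapColumns M i i′) ≈ - det m M
  det-swap-adjacent-columns m M i i′ adjacent = +-inverseʳ-unique (det m M) _ (begin
    det m M + det m (D Mi′ Mi)                            ≈⟨ +-congʳ (det-cong m (withColumns-own M i i′)) ⟨
    det m (D Mi Mi′) + det m (D Mi′ Mi)                   ≈⟨ +-cong (+-identityˡ _) (+-identityʳ _) ⟨
    (0# + det m (D Mi Mi′)) + (det m (D Mi′ Mi) + 0#)
      ≈⟨ +-cong (+-congʳ (repeated Mi)) (+-congˡ (repeated Mi′)) ⟨
    (det m (D Mi Mi) + det m (D Mi Mi′)) + (det m (D Mi′ Mi) + det m (D Mi′ Mi′))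
      ≈⟨ +-cong (additive-second Mi) (additive-second Mi′) ⟨
    det m (D Mi S) + det m (D Mi′ S)                      ≈⟨ additive-first ⟨
    det m (D S S)                                         ≈⟨ repeated S ⟩
    0#                                                    ∎)
    where
    i′≢i : i′ ≢ i
    i′≢i e = ℕ.1+n≢n (≡.sym (≡.trans (≡.cong toℕ (≡.sym e)) adjacent))
    D : (X Y : Fin m → Carrier) → Matrix m
    D = withColumns M i i′
    Mi Mi′ S : Fin m → Carrier
    Mi = column M i
    Mi′ = column M i′
    S r = Mi r + Mi′ r
    repeated : ∀ X → det m (D X X) ≈ 0#
    repeated X = det-adjacent-equal-columns m (D X X) (toℕ i) (≡.subst (_< m) adjacent (Fin.toℕ<n i′))
      λ r k k′ e e′ → ≡.subst₂ (λ u v → D X X r u ≈ D X X r v)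
        (≡.sym (Fin.toℕ-injective e)) (≡.sym (Fin.toℕ-injective (≡.trans e′ (≡.sym adjacent))))
        (reflexive (≡.trans (withColumns-first M i i′ X X r) (≡.sym (withColumns-second M i i′ i′≢i X X r))))
    additive-first : det m (D S S) ≈ det m (D Mi S) + det m (D Mi′ S)
    additive-first = det-additive-column m i _ _ _
      (withColumns-agree-first M i i′ Mi S S) (withColumns-agree-first M i i′ Mi′ S S)
      (λ r → reflexive (≡.trans (withColumns-first M i i′ S S r)
        (≡.sym (≡.cong₂ _+_ (withColumns-first M i i′ Mi S r) (withColumns-first M i i′ Mi′ S r)))))
    additive-second : ∀ X → det m (D X S) ≈ det m (D X Mi) + det m (D X Mi′)
    additive-second X = det-additive-column m i′ _ _ _
      (withColumns-agree-second M i i′ X Mi S) (withColumns-agree-second M i i′ X Mi′ S)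
      (λ r → reflexive (≡.trans (withColumns-second M i i′ i′≢i X S r)
        (≡.sym (≡.cong₂ _+_ (withColumns-second M i i′ i′≢i X Mi r) (withColumns-second M i i′ i′≢i X Mi′ r)))))

  det-equal-columns-at-distance : ∀ d m (M : Matrix m) (i i′ : Fin m) → toℕ i′ ≡ suc (d ℕ.+ toℕ i) →
    (∀ r → M r i ≈ M r i′) → det m M ≈ 0#
  det-equal-columns-at-distance zero m M i i′ adjacent same =
    det-adjacent-equal-columns m M (toℕ i) (≡.subst (_< m) adjacent (Fin.toℕ<n i′)) λ r k k′ e e′ →
      ≡.subst₂ (λ u v → M r u ≈ M r v) (≡.sym (Fin.toℕ-injective e))
        (≡.sym (Fin.toℕ-injective (≡.trans e′ (≡.sym adjacent)))) (same r)
  det-equal-columns-at-distance (suc d) m M i i′ distance same = begin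
    det m M                    ≈⟨ -‿involutive _ ⟨
    - (- det m M)              ≈⟨ -‿cong (det-swap-adjacent-columns m M i″ i′ i′-adjacent) ⟨
    - det m (swapColumns M i″ i′) ≈⟨ -‿cong (det-equal-columns-at-distance d m _ i i″ i″-distance same′) ⟩
    - 0#                       ≈⟨ -0#≈0# ⟩
    0#                         ∎
    where
    i″<m : suc (d ℕ.+ toℕ i) < m
    i″<m = ℕ.<-trans (ℕ.n<1+n _) (≡.subst (_< m) distance (Fin.toℕ<n i′))
    i″ : Fin m
    i″ = fromℕ< i″<m
    i″-distance : toℕ i″ ≡ suc (d ℕ.+ toℕ i)
    i″-distance = Fin.toℕ-fromℕ< i″<m
    i′-adjacent : toℕ i′ ≡ suc (toℕ i″)
    i′-adjacent = ≡.trans distance (≡.cong suc (≡.sym i″-distance))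
    i≢i″ : i ≢ i″
    i≢i″ e = ℕ.m≢1+n+m (toℕ i) (≡.trans (≡.cong toℕ e) i″-distance)
    i≢i′ : i ≢ i′
    i≢i′ e = ℕ.m≢1+n+m (toℕ i) (≡.trans (≡.cong toℕ e) distance)
    same′ : ∀ r → swapColumns M i″ i′ r i ≈ swapColumns M i″ i′ r i″
    same′ r = trans (reflexive (withColumns-other M i″ i′ _ _ r i i≢i″ i≢i′))
                (trans (same r) (reflexive (≡.sym (withColumns-first M i″ i′ (column M i′) (column M i″) r))))

  det-equal-columns : ∀ m (M : Matrix m) (i i′ : Fin m) → i ≢ i′ → (∀ r → M r i ≈ M r i′) → det m M ≈ 0#
  det-equal-columns m M i i′ i≢i′ same with ℕ.<-cmp (toℕ i) (toℕ i′)
  ... | tri< i<i′ _ _ = det-equal-columns-at-distance _ m M i i′ (m<n⇒n≡1+[n∸1+m]+m i<i′) same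
  ... | tri≈ _ e _    = ⊥-elim (i≢i′ (Fin.toℕ-injective e))
  ... | tri> _ _ i′<i = det-equal-columns-at-distance _ m M i′ i (m<n⇒n≡1+[n∸1+m]+m i′<i) (λ r → sym (same r))

  setColumn : ∀ {m} → Matrix m → Fin m → (Fin m → Carrier) → Matrix m
  setColumn M k v r = updateAt (M r) k (const (v r))

  setColumn-at : ∀ {m} (M : Matrix m) k v r → setColumn M k v r k ≡ v r
  setColumn-at M k v r = updateAt-updates k (M r)

  setColumn-agree : ∀ {m} (M : Matrix m) k v → AgreeOffColumn k (setColumn M k v) M
  setColumn-agree M k v r j j≢k = reflexive (updateAt-minimal j k (M r) j≢k)

  det-zero-column : ∀ m (M : Matrix m) k → (∀ r → M r k ≈ 0#) → det m M ≈ 0#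
  det-zero-column m M k column≈0 = x+x≈x⇒x≈0 (det m M) (sym
    (det-additive-column m k M M M (λ _ _ _ → refl) (λ _ _ _ → refl)
      λ r → trans (column≈0 r) (sym (trans (+-cong (column≈0 r) (column≈0 r)) (+-identityˡ 0#)))))

  det-scale-column : ∀ m (A : Matrix m) k l v → det m (setColumn A k (λ r → l * v r)) ≈ l * det m (setColumn A k v)
  det-scale-column m A k l v = begin
    det m (setColumn A k lv)                  ≈⟨ det-linear-column m k l _ _ _
      (λ r j j≢k → trans (setColumn-agree A k v r j j≢k) (sym (setColumn-agree A k lv r j j≢k)))
      (λ r j j≢k → trans (setColumn-agree A k (const 0#) r j j≢k) (sym (setColumn-agree A k lv r j j≢k)))
      (λ r → trans (reflexive (setColumn-at A k lv r)) (trans (sym (+-identityʳ _))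
               (reflexive (≡.sym (≡.cong₂ (λ x y → l * x + y) (setColumn-at A k v r) (setColumn-at A k (const 0#) r)))))) ⟩
    l * det m (setColumn A k v) + det m (setColumn A k (const 0#))
      ≈⟨ +-congˡ (det-zero-column m _ k (λ r → reflexive (setColumn-at A k _ r))) ⟩
    l * det m (setColumn A k v) + 0#                        ≈⟨ +-identityʳ _ ⟩
    l * det m (setColumn A k v)                             ∎
    where
    lv : Fin m → Carrier
    lv r = l * v r

  det-sum-column : ∀ m n (A C : Matrix m) (k : Fin m) (V : Fin n → Fin m → Carrier) →
    AgreeOffColumn k A C → (∀ r → C r k ≈ ∑[ t < n ] V t r) →
    det m C ≈ ∑[ t < n ] det m (setColumn A k (V t))
  det-sum-column m zero    A C k V A∼C Cₖ = det-zero-column m C k Cₖ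
  det-sum-column m (suc n) A C k V A∼C Cₖ = begin
    det m C ≈⟨ det-additive-column m k _ _ C (agree (V zero)) (agree rest) (λ r →
                 trans (Cₖ r) (reflexive (≡.sym (≡.cong₂ _+_ (setColumn-at A k (V zero) r) (setColumn-at A k rest r))))) ⟩
    det m (setColumn A k (V zero)) + det m (setColumn A k rest)
      ≈⟨ +-congˡ (det-sum-column m n A _ k (λ t → V (suc t)) (λ r j j≢k → sym (setColumn-agree A k rest r j j≢k))
                   (λ r → reflexive (setColumn-at A k rest r))) ⟩
    det m (setColumn A k (V zero)) + ∑[ t < n ] det m (setColumn A k (V (suc t))) ∎
    where
    rest : Fin m → Carrier
    rest r = ∑[ t < n ] V (suc t) r
    agree : ∀ v → AgreeOffColumn k (setColumn A k v) C
    agree v r j j≢k = trans (setColumn-agree A k v r j j≢k) (A∼C r j j≢k)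

  det-column-combination : ∀ m (A C : Matrix m) (k : Fin m) (coeff : Fin m → Carrier) →
    AgreeOffColumn k A C → (∀ r → C r k ≈ ∑[ b < m ] (A r b * coeff b)) → det m C ≈ coeff k * det m A
  det-column-combination m A C k coeff A∼C Cₖ = begin
    det m C                                                  ≈⟨ det-sum-column m m A C k _ A∼C Cₖ′ ⟩
    ∑[ b < m ] det m (setColumn A k (λ r → coeff b * A r b)) ≈⟨ sum-cong-≋ (λ b → det-scale-column m A k (coeff b) (column A b)) ⟩
    ∑[ b < m ] (coeff b * det m (setColumn A k (column A b))) ≈⟨ sum-single k others ⟩
    coeff k * det m (setColumn A k (column A k))             ≈⟨ *-congˡ (det-cong m restored) ⟩
    coeff k * det m A                                        ∎
    where
    Cₖ′ : ∀ r → C r k ≈ ∑[ b < m ] (coeff b * A r b)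
    Cₖ′ r = trans (Cₖ r) (sum-cong-≋ λ b → *-comm (A r b) (coeff b))
    others : ∀ b → b ≢ k → coeff b * det m (setColumn A k (column A b)) ≈ 0#
    others b b≢k = trans (*-congˡ (det-equal-columns m _ b k b≢k λ r →
      reflexive (≡.trans (updateAt-minimal b k (A r) b≢k) (≡.sym (setColumn-at A k (column A b) r))))) (zeroʳ _)
    restored : ∀ r j → setColumn A k (column A k) r j ≈ A r j
    restored r j = reflexive (updateAt-id-local k (A r) ≡.refl j)

  det-*-upper-triangular : ∀ m (M N T : Matrix m) (d : Carrier) →
    (∀ b k → toℕ k < toℕ b → T b k ≈ 0#) → (∀ k → T k k ≈ d) →
    (∀ r k → N r k ≈ ∑[ b < m ] (M r b * T b k)) → det m N ≈ d ^ m * det m M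
  det-*-upper-triangular m M N T d lower diagonal N≈MT =
    trans (det-cong m (λ r j → reflexive (≡.sym (mixed-≥ 0 r j z≤n)))) (replace-all m 0 ≡.refl)
    where
    mixed : ℕ → Matrix m
    mixed k r j with toℕ j ℕ.<? k
    ... | yes _ = M r j
    ... | no _  = N r j

    mixed-< : ∀ k r j → toℕ j < k → mixed k r j ≡ M r j
    mixed-< k r j j<k with toℕ j ℕ.<? k
    ... | yes _  = ≡.refl
    ... | no j≮k = ⊥-elim (j≮k j<k)

    mixed-≥ : ∀ k r j → k ≤ toℕ j → mixed k r j ≡ N r j
    mixed-≥ k r j k≤j with toℕ j ℕ.<? k
    ... | yes j<k = ⊥-elim (ℕ.<⇒≱ j<k k≤j)
    ... | no _    = ≡.refl

    replace-column : ∀ k (k<m : k < m) → det m (mixed k) ≈ d * det m (mixed (suc k))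
    replace-column k k<m = trans (det-column-combination m _ _ c (λ b → T b c) agree combination)
                                 (*-congʳ (diagonal c))
      where
      c = fromℕ< k<m
      c≡k : toℕ c ≡ k
      c≡k = Fin.toℕ-fromℕ< k<m
      agree : AgreeOffColumn c (mixed (suc k)) (mixed k)
      agree r j j≢c with ℕ.<-cmp (toℕ j) k
      ... | tri< j<k _ _ = reflexive (≡.trans (mixed-< (suc k) r j (ℕ.m<n⇒m<1+n j<k)) (≡.sym (mixed-< k r j j<k)))
      ... | tri≈ _ j≡k _ = ⊥-elim (j≢c (Fin.toℕ-injective (≡.trans j≡k (≡.sym c≡k))))
      ... | tri> _ _ k<j = reflexive (≡.trans (mixed-≥ (suc k) r j k<j) (≡.sym (mixed-≥ k r j (ℕ.<⇒≤ k<j))))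
      same-term : ∀ r b → M r b * T b c ≈ mixed (suc k) r b * T b c
      same-term r b with toℕ b ℕ.≤? k
      ... | yes b≤k = reflexive (≡.cong (_* T b c) (≡.sym (mixed-< (suc k) r b (s≤s b≤k))))
      ... | no b≰k  = trans (*-congˡ T≈0) (trans (zeroʳ _) (sym (trans (*-congˡ T≈0) (zeroʳ _))))
        where
        T≈0 : T b c ≈ 0#
        T≈0 = lower b c (≡.subst (_< toℕ b) (≡.sym c≡k) (ℕ.≰⇒> b≰k))
      combination : ∀ r → mixed k r c ≈ ∑[ b < m ] (mixed (suc k) r b * T b c)
      combination r = trans (reflexive (mixed-≥ k r c (ℕ.≤-reflexive (≡.sym c≡k))))
                            (trans (N≈MT r c) (sum-cong-≋ (same-term r)))

    replace-all : ∀ t k → k ℕ.+ t ≡ m → det m (mixed k) ≈ d ^ t * det m M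
    replace-all zero k k+0≡m = trans (det-cong m λ r j → reflexive (mixed-< k r j
        (≡.subst (toℕ j <_) (≡.trans (≡.sym k+0≡m) (ℕ.+-identityʳ k)) (Fin.toℕ<n j))))
      (sym (*-identityˡ _))
    replace-all (suc t) k k+1+t≡m = begin
      det m (mixed k)             ≈⟨ replace-column k (≡.subst (k <_) k+1+t≡m (ℕ.m<m+n k (s≤s z≤n))) ⟩
      d * det m (mixed (suc k))   ≈⟨ *-congˡ (replace-all t (suc k) (≡.trans (≡.sym (ℕ.+-suc k t)) k+1+t≡m)) ⟩
      d * (d ^ t * det m M)       ≈⟨ *-assoc _ _ _ ⟨
      d ^ suc t * det m M         ∎

  rowMinor : ∀ {m} → Fin (suc m) → Matrix (suc m) → Matrix m
  rowMinor i M r k = M (punchIn i r) (suc k)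

  det-expand-first-column : ∀ m (M : Matrix (suc m)) →
    det (suc m) M ≈ ∑[ i < suc m ] (sign (toℕ i) * (M i zero * det m (rowMinor i M)))
  det-expand-first-column zero    M = refl
  det-expand-first-column (suc m) M = +-congˡ (begin
    ∑[ j < suc m ] (- sign (toℕ j) * (M zero (suc j) * det (suc m) (minor (suc j) M)))
      ≈⟨ sum-cong-≋ (λ j → *-congˡ {x = - sign (toℕ j)} (*-congˡ {x = M zero (suc j)} (det-expand-first-column m (minor (suc j) M)))) ⟩
    ∑[ j < suc m ] (- sign (toℕ j) * (M zero (suc j) * (∑[ i < suc m ] (sign (toℕ i) * (M (suc i) zero * D i j)))))
      ≈⟨ sum-cong-≋ (λ j → trans (distribute (- sign (toℕ j)) (M zero (suc j)) (λ i → sign (toℕ i) * (M (suc i) zero * D i j))) (sum-cong-≋ (λ i → rearrangeʳ i j))) ⟩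
    ∑[ j < suc m ] (∑[ i < suc m ] (- G i j))
      ≈⟨ ∑-comm (λ j i → - G i j) ⟩
    ∑[ i < suc m ] (∑[ j < suc m ] (- G i j))
      ≈⟨ sum-cong-≋ (λ i → trans (distribute (- sign (toℕ i)) (M (suc i) zero) (λ j → sign (toℕ j) * (M zero (suc j) * D i j))) (sum-cong-≋ (λ j → rearrangeˡ i j))) ⟨
    ∑[ i < suc m ] (- sign (toℕ i) * (M (suc i) zero * (∑[ j < suc m ] (sign (toℕ j) * (M zero (suc j) * D i j))))) ∎)
    where
    D : Fin (suc m) → Fin (suc m) → Carrier
    D i j = det m (λ r k → M (suc (punchIn i r)) (suc (punchIn j k)))
    G : Fin (suc m) → Fin (suc m) → Carrier
    G i j = sign (toℕ i) * sign (toℕ j) * (M zero (suc j) * (M (suc i) zero * D i j))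
    distribute : ∀ x y (f : Fin (suc m) → Carrier) → x * (y * sum f) ≈ ∑[ i < suc m ] (x * (y * f i))
    distribute x y f = trans (*-congˡ (*-distribˡ-sum y f)) (*-distribˡ-sum x (λ i → y * f i))
    rearrangeʳ : ∀ i j → - sign (toℕ j) * (M zero (suc j) * (sign (toℕ i) * (M (suc i) zero * D i j))) ≈ - G i j
    rearrangeʳ i j = trans (sym (-‿distribˡ-* _ _)) (-‿cong
      (solve 5 (λ a b c d e → a ⊕ (b ⊕ (c ⊕ (d ⊕ e))) ⊜ (c ⊕ a) ⊕ (b ⊕ (d ⊕ e))) refl _ _ _ _ _))
    rearrangeˡ : ∀ i j → - sign (toℕ i) * (M (suc i) zero * (sign (toℕ j) * (M zero (suc j) * D i j))) ≈ - G i j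
    rearrangeˡ i j = trans (sym (-‿distribˡ-* _ _)) (-‿cong
      (solve 5 (λ a b c d e → a ⊕ (b ⊕ (c ⊕ (d ⊕ e))) ⊜ (a ⊕ c) ⊕ (d ⊕ (b ⊕ e))) refl _ _ _ _ _))

  det-transpose : ∀ m (M : Matrix m) → det m (transpose M) ≈ det m M
  det-transpose zero    M = refl
  det-transpose (suc m) M = trans
    (sum-cong-≋ λ j → *-congˡ {x = sign (toℕ j)} (*-congˡ {x = M j zero} (det-transpose m (rowMinor j M))))
    (sym (det-expand-first-column m M))

  δ : ℕ → ℕ → Carrier
  δ a b with a ℕ.≟ b
  ... | yes _ = 1#
  ... | no _  = 0#

  δ-≡ : ∀ {a b} → a ≡ b → δ a b ≡ 1#
  δ-≡ {a} {b} a≡b with a ℕ.≟ b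
  ... | yes _  = ≡.refl
  ... | no a≢b = ⊥-elim (a≢b a≡b)

  δ-≢ : ∀ {a b} → a ≢ b → δ a b ≡ 0#
  δ-≢ {a} {b} a≢b with a ℕ.≟ b
  ... | yes a≡b = ⊥-elim (a≢b a≡b)
  ... | no _    = ≡.refl

  δ-cong : ∀ {a b a′ b′} → (a ≡ b → a′ ≡ b′) → (a′ ≡ b′ → a ≡ b) → δ a b ≡ δ a′ b′
  δ-cong {a} {b} to from with a ℕ.≟ b
  ... | yes a≡b = ≡.sym (δ-≡ (to a≡b))
  ... | no a≢b  = ≡.sym (δ-≢ (λ e → a≢b (from e)))

  sign-squared : ∀ n → sign n * sign n ≈ 1#
  sign-squared zero    = *-identityˡ 1#
  sign-squared (suc n) = trans (sym (-‿distribˡ-* _ _)) (trans (-‿cong (sym (-‿distribʳ-* _ _)))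
                           (trans (-‿involutive _) (sign-squared n)))

  -- Row i < k of M is the unit vector with its 1 in column k − 1 − i.
  det-reversed-identity-block : ∀ k p (M : Matrix (k ℕ.+ p)) →
    (∀ i j → toℕ i < k → M i j ≈ δ (suc (toℕ i ℕ.+ toℕ j)) k) →
    ∃ λ ε → ε * ε ≈ 1# × det (k ℕ.+ p) M ≈ ε * det p (λ r s → M (k ↑ʳ r) (k ↑ʳ s))
  det-reversed-identity-block zero    p M _    = 1# , *-identityˡ 1# , sym (*-identityˡ _)
  det-reversed-identity-block (suc k) p M rows = sign k * ε , unit , expansion
    where
    k<1+k+p : k < suc (k ℕ.+ p)
    k<1+k+p = s≤s (ℕ.m≤m+n k p)
    pivot : Fin (suc (k ℕ.+ p))
    pivot = fromℕ< k<1+k+p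
    pivot≡k : toℕ pivot ≡ k
    pivot≡k = Fin.toℕ-fromℕ< k<1+k+p

    minor-rows : ∀ i j → toℕ i < k → minor pivot M i j ≈ δ (suc (toℕ i ℕ.+ toℕ j)) k
    minor-rows i j i<k = trans (rows (suc i) (punchIn pivot j) (s≤s i<k)) (reflexive shifted)
      where
      shifted : δ (suc (suc (toℕ i ℕ.+ toℕ (punchIn pivot j)))) (suc k) ≡ δ (suc (toℕ i ℕ.+ toℕ j)) k
      shifted with toℕ j ℕ.<? k
      ... | yes j<k = ≡.trans (≡.cong (λ z → δ (suc (suc (toℕ i ℕ.+ z))) (suc k))
                                      (toℕ-punchIn-< pivot j (≡.subst (toℕ j <_) (≡.sym pivot≡k) j<k)))
                              (δ-cong {a = suc (suc (toℕ i ℕ.+ toℕ j))} {b = suc k} ℕ.suc-injective (≡.cong suc))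
      ... | no j≮k = ≡.trans (δ-≢ λ e → ℕ.<⇒≢ k<1+i+j′ (≡.sym (ℕ.suc-injective e)))
                             (≡.sym (δ-≢ λ e → ℕ.<⇒≢ k<1+i+j (≡.sym e)))
        where
        k<1+i+j : k < suc (toℕ i ℕ.+ toℕ j)
        k<1+i+j = s≤s (ℕ.≤-trans (ℕ.≮⇒≥ j≮k) (ℕ.m≤n+m (toℕ j) (toℕ i)))
        k<1+i+j′ : k < suc (toℕ i ℕ.+ toℕ (punchIn pivot j))
        k<1+i+j′ = ℕ.<-≤-trans k<1+i+j (s≤s (ℕ.+-monoʳ-≤ (toℕ i) (ℕ.≤-trans (ℕ.n≤1+n _)
                     (ℕ.≤-reflexive (≡.sym (toℕ-punchIn-≥ pivot j (≡.subst (_≤ toℕ j) (≡.sym pivot≡k) (ℕ.≮⇒≥ j≮k))))))))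

    IH = det-reversed-identity-block k p (minor pivot M) minor-rows
    ε = proj₁ IH

    unit : sign k * ε * (sign k * ε) ≈ 1#
    unit = trans (solve 2 (λ a b → (a ⊕ b) ⊕ (a ⊕ b) ⊜ (a ⊕ a) ⊕ (b ⊕ b)) refl (sign k) ε)
             (trans (*-cong (sign-squared k) (proj₁ (proj₂ IH))) (*-identityˡ 1#))

    off-pivot : ∀ j → j ≢ pivot → sign (toℕ j) * (M zero j * det (k ℕ.+ p) (minor j M)) ≈ 0#
    off-pivot j j≢pivot = trans (*-congˡ (*-congʳ (trans (rows zero j (s≤s z≤n))
                                  (reflexive (δ-≢ λ e → j≢pivot (Fin.toℕ-injective (≡.trans (ℕ.suc-injective e) (≡.sym pivot≡k))))))))
                                (trans (*-congˡ (zeroˡ _)) (zeroʳ _))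

    block : ∀ r s → minor pivot M (k ↑ʳ r) (k ↑ʳ s) ≡ M (suc k ↑ʳ r) (suc k ↑ʳ s)
    block r s = ≡.cong (M (suc (k ↑ʳ r))) (Fin.toℕ-injective (toℕ-punchIn-≥ pivot (k ↑ʳ s)
      (≡.subst₂ _≤_ (≡.sym pivot≡k) (≡.sym (Fin.toℕ-↑ʳ k s)) (ℕ.m≤m+n k (toℕ s)))))

    expansion : det (suc k ℕ.+ p) M ≈ sign k * ε * det p (λ r s → M (suc k ↑ʳ r) (suc k ↑ʳ s))
    expansion = begin
      det (suc k ℕ.+ p) M                                       ≈⟨ sum-single pivot off-pivot ⟩
      sign (toℕ pivot) * (M zero pivot * det (k ℕ.+ p) (minor pivot M))
        ≈⟨ *-cong (reflexive (≡.cong sign pivot≡k)) (*-congʳ (trans (rows zero pivot (s≤s z≤n)) (reflexive (δ-≡ (≡.cong suc pivot≡k))))) ⟩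
      sign k * (1# * det (k ℕ.+ p) (minor pivot M))             ≈⟨ *-congˡ (*-identityˡ _) ⟩
      sign k * det (k ℕ.+ p) (minor pivot M)                    ≈⟨ *-congˡ (proj₂ (proj₂ IH)) ⟩
      sign k * (ε * det p (λ r s → minor pivot M (k ↑ʳ r) (k ↑ʳ s))) ≈⟨ *-assoc _ _ _ ⟨
      sign k * ε * det p (λ r s → minor pivot M (k ↑ʳ r) (k ↑ʳ s))   ≈⟨ *-congˡ (det-cong p (λ r s → reflexive (block r s))) ⟩
      sign k * ε * det p (λ r s → M (suc k ↑ʳ r) (suc k ↑ʳ s))       ∎

module HankelReduction {ℓ₁ ℓ₂} (R : CommutativeRing ℓ₁ ℓ₂) where
  open CommutativeRing R hiding (zero)
  open import Algebra.Properties.Ring ring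
  open import Algebra.Properties.Semiring.Sum semiring
  open CommutativeMonoidSum +-commutativeMonoid
  open import Algebra.Definitions.RawSemiring (Semiring.rawSemiring semiring) using (_^_)
  open import Algebra.Solver.CommutativeMonoid *-commutativeMonoid using (solve; _⊕_; _⊜_)
  open import Relation.Binary.Reasoning.Setoid setoid
  open Determinant R

  sumℕ : ℕ → (ℕ → Carrier) → Carrier
  sumℕ N f = ∑[ e < N ] f (toℕ e)

  sumℕ-cong : ∀ N {f g : ℕ → Carrier} → (∀ e → e < N → f e ≈ g e) → sumℕ N f ≈ sumℕ N g
  sumℕ-cong N f≈g = sum-cong-≋ λ e → f≈g (toℕ e) (Fin.toℕ<n e)

  sumℕ-zero : ∀ N {f : ℕ → Carrier} → (∀ e → e < N → f e ≈ 0#) → sumℕ N f ≈ 0#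
  sumℕ-zero N f≈0 = sum-zero λ e → f≈0 (toℕ e) (Fin.toℕ<n e)

  sumℕ-+ : ∀ K L (f : ℕ → Carrier) → sumℕ (K ℕ.+ L) f ≈ sumℕ K f + sumℕ L (λ e → f (K ℕ.+ e))
  sumℕ-+ zero    L f = sym (+-identityˡ _)
  sumℕ-+ (suc K) L f = trans (+-congˡ (sumℕ-+ K L (λ e → f (suc e)))) (sym (+-assoc _ _ _))

  sumℕ-last : ∀ N (f : ℕ → Carrier) → sumℕ (suc N) f ≈ sumℕ N f + f N
  sumℕ-last zero    f = trans (+-identityʳ _) (sym (+-identityˡ _))
  sumℕ-last (suc N) f = trans (+-congˡ (sumℕ-last N (λ e → f (suc e)))) (sym (+-assoc _ _ _))

  sumℕ-neg : ∀ N (f : ℕ → Carrier) → sumℕ N (λ e → - f e) ≈ - sumℕ N f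
  sumℕ-neg zero    f = sym -0#≈0#
  sumℕ-neg (suc N) f = trans (+-congˡ (sumℕ-neg N (λ e → f (suc e)))) (-‿+-comm _ _)

  sumℕ-reverse : ∀ N (f : ℕ → Carrier) → sumℕ N f ≈ sumℕ N (λ e → f (N ∸ suc e))
  sumℕ-reverse zero    f = refl
  sumℕ-reverse (suc N) f = begin
    f 0 + sumℕ N (λ e → f (suc e))            ≈⟨ +-congˡ (sumℕ-reverse N (λ e → f (suc e))) ⟩
    f 0 + sumℕ N (λ e → f (suc (N ∸ suc e)))  ≈⟨ +-comm _ _ ⟩
    sumℕ N (λ e → f (suc (N ∸ suc e))) + f 0
      ≈⟨ +-cong (sumℕ-cong N (λ e e<N → reflexive (≡.cong f (≡.sym (ℕ.+-∸-assoc 1 e<N)))))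
                (reflexive (≡.cong f (≡.sym (ℕ.n∸n≡0 N)))) ⟩
    sumℕ N (λ e → f (N ∸ e)) + f (N ∸ N)      ≈⟨ sumℕ-last N (λ e → f (N ∸ e)) ⟨
    sumℕ (suc N) (λ e → f (N ∸ e))            ∎

  module Reciprocal (g : ℕ → Carrier) (g₀⁻¹ : Carrier) where

    -- approx M e is the e-th coefficient of 1/g for e ≤ M (junk for e > M); tabulating
    -- whole stages avoids a well-founded recursion on the indices M ∸ e.
    approx : ℕ → ℕ → Carrier
    approx zero    e = g₀⁻¹
    approx (suc M) e with e ≤? M
    ... | yes _ = approx M e
    ... | no _  = - (g₀⁻¹ * sumℕ (suc M) (λ e′ → g (suc e′) * approx M (M ∸ e′)))

    coeff : ℕ → Carrier
    coeff M = approx M M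

    approx-suc : ∀ M e → e ≤ M → approx (suc M) e ≡ approx M e
    approx-suc M e e≤M with e ≤? M
    ... | yes _   = ≡.refl
    ... | no e≰M  = ⊥-elim (e≰M e≤M)

    approx-stable : ∀ M e → e ≤ M → approx M e ≡ coeff e
    approx-stable zero    zero    z≤n = ≡.refl
    approx-stable (suc M) e e≤1+M with ℕ.m≤n⇒m<n∨m≡n e≤1+M
    ... | inj₁ e<1+M  = ≡.trans (approx-suc M e (ℕ.≤-pred e<1+M)) (approx-stable M e (ℕ.≤-pred e<1+M))
    ... | inj₂ ≡.refl = ≡.refl

    coeff-suc : ∀ M → coeff (suc M) ≈ - (g₀⁻¹ * sumℕ (suc M) (λ e → g (suc e) * coeff (M ∸ e)))
    coeff-suc M with suc M ≤? M
    ... | yes 1+M≤M = ⊥-elim (ℕ.<-irrefl ≡.refl 1+M≤M)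
    ... | no _      = -‿cong (*-congˡ (sumℕ-cong (suc M) λ e _ →
                        *-congˡ {x = g (suc e)} (reflexive (approx-stable M (M ∸ e) (ℕ.m∸n≤m M e)))))

    convolution : g 0 * g₀⁻¹ ≈ 1# → ∀ N → sumℕ (suc N) (λ e → g e * coeff (N ∸ e)) ≈ δ N 0
    convolution inverse zero    = trans (+-identityʳ _) inverse
    convolution inverse (suc M) = begin
      g 0 * coeff (suc M) + S            ≈⟨ +-congʳ (*-congˡ (coeff-suc M)) ⟩
      g 0 * - (g₀⁻¹ * S) + S             ≈⟨ +-congʳ (sym (-‿distribʳ-* _ _)) ⟩
      - (g 0 * (g₀⁻¹ * S)) + S           ≈⟨ +-congʳ (-‿cong (trans (sym (*-assoc _ _ _)) (trans (*-congʳ inverse) (*-identityˡ S)))) ⟩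
      - S + S                            ≈⟨ -‿inverseˡ S ⟩
      0#                                 ≡⟨ ≡.sym (δ-≢ {suc M} {0} (λ ())) ⟩
      δ (suc M) 0                        ∎
      where
      S = sumℕ (suc M) (λ e → g (suc e) * coeff (M ∸ e))

  reciprocal-local : ∀ (g g′ : ℕ → Carrier) g₀⁻¹ E → (∀ e → e ≤ E → g e ≈ g′ e) →
    ∀ e → e ≤ E → Reciprocal.coeff g g₀⁻¹ e ≈ Reciprocal.coeff g′ g₀⁻¹ e
  reciprocal-local g g′ g₀⁻¹ E g≈g′ e e≤E = local e e ℕ.≤-refl e≤E
    where
    module U = Reciprocal g g₀⁻¹
    module U′ = Reciprocal g′ g₀⁻¹
    local : ∀ N e → e ≤ N → N ≤ E → U.coeff e ≈ U′.coeff e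
    local N       zero    _         _     = refl
    local (suc N) (suc M) 1+M≤1+N 1+N≤E = trans (U.coeff-suc M) (trans (-‿cong (*-congˡ (sumℕ-cong (suc M) λ e e≤M →
      *-cong (g≈g′ (suc e) (ℕ.≤-trans e≤M (ℕ.≤-trans 1+M≤1+N 1+N≤E)))
             (local N (M ∸ e) (ℕ.≤-trans (ℕ.m∸n≤m M e) (ℕ.≤-pred 1+M≤1+N)) (ℕ.≤-trans (ℕ.n≤1+n N) 1+N≤E)))))
      (sym (U′.coeff-suc M)))

  Hankel : ∀ m → (ℕ → Carrier) → Matrix m
  Hankel m s r k = s (toℕ r ℕ.+ toℕ k)

  upperToeplitz : (ℕ → Carrier) → ℕ → ℕ → Carrier
  upperToeplitz a b k with b ≤? k
  ... | yes _ = a (k ∸ b)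
  ... | no _  = 0#

  upperToeplitz-≤ : ∀ a {b k} → b ≤ k → upperToeplitz a b k ≡ a (k ∸ b)
  upperToeplitz-≤ a {b} {k} b≤k with b ≤? k
  ... | yes _   = ≡.refl
  ... | no b≰k  = ⊥-elim (b≰k b≤k)

  upperToeplitz-> : ∀ a {b k} → k < b → upperToeplitz a b k ≡ 0#
  upperToeplitz-> a {b} {k} k<b with b ≤? k
  ... | yes b≤k = ⊥-elim (ℕ.<⇒≱ k<b b≤k)
  ... | no _    = ≡.refl

  upperToeplitz-diagonal : ∀ a k → upperToeplitz a k k ≡ a 0
  upperToeplitz-diagonal a k = ≡.trans (upperToeplitz-≤ a {k} {k} ℕ.≤-refl) (≡.cong a (ℕ.n∸n≡0 k))

  sum-*-upperToeplitz : ∀ N k (f a : ℕ → Carrier) → k < N →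
    sumℕ N (λ b → f b * upperToeplitz a b k) ≈ sumℕ (suc k) (λ b → f b * a (k ∸ b))
  sum-*-upperToeplitz N k f a k<N = begin
    sumℕ N F                                                    ≡⟨ ≡.cong (λ z → sumℕ z F) (≡.sym N≡1+k+t) ⟩
    sumℕ (suc k ℕ.+ (N ∸ suc k)) F                              ≈⟨ sumℕ-+ (suc k) (N ∸ suc k) F ⟩
    sumℕ (suc k) F + sumℕ (N ∸ suc k) (λ e → F (suc k ℕ.+ e))
      ≈⟨ +-cong (sumℕ-cong (suc k) λ b b≤k → *-congˡ {x = f b} (reflexive (upperToeplitz-≤ a (ℕ.≤-pred b≤k))))
                (sumℕ-zero (N ∸ suc k) λ e _ → trans (*-congˡ {x = f (suc k ℕ.+ e)} (reflexive (upperToeplitz-> a (s≤s (ℕ.m≤m+n k e))))) (zeroʳ _)) ⟩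
    sumℕ (suc k) (λ b → f b * a (k ∸ b)) + 0#                   ≈⟨ +-identityʳ _ ⟩
    sumℕ (suc k) (λ b → f b * a (k ∸ b))                        ∎
    where
    F : ℕ → Carrier
    F b = f b * upperToeplitz a b k
    N≡1+k+t : suc k ℕ.+ (N ∸ suc k) ≡ N
    N≡1+k+t = ℕ.m+[n∸m]≡n k<N

  Unit : Carrier → Set (ℓ₁ ⊔ ℓ₂)
  Unit a = ∃ λ b → a * b ≈ 1#

  unit-* : ∀ {a b} → Unit a → Unit b → Unit (a * b)
  unit-* (a⁻¹ , aa⁻¹≈1) (b⁻¹ , bb⁻¹≈1) = a⁻¹ * b⁻¹ ,
    trans (solve 4 (λ a b c d → (a ⊕ b) ⊕ (c ⊕ d) ⊜ (a ⊕ c) ⊕ (b ⊕ d)) refl _ _ _ _)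
          (trans (*-cong aa⁻¹≈1 bb⁻¹≈1) (*-identityˡ 1#))

  unit-^ : ∀ {a} n → Unit a → Unit (a ^ n)
  unit-^ zero    _    = 1# , *-identityˡ 1#
  unit-^ (suc n) unit = unit-* unit (unit-^ n unit)

  unit-cancel : ∀ {a} x → Unit a → a * x ≈ 0# → x ≈ 0#
  unit-cancel {a} x (a⁻¹ , aa⁻¹≈1) ax≈0 = begin
    x               ≈⟨ *-identityˡ x ⟨
    1# * x          ≈⟨ *-congʳ (trans (*-comm _ _) aa⁻¹≈1) ⟨
    (a⁻¹ * a) * x   ≈⟨ *-assoc _ _ _ ⟩
    a⁻¹ * (a * x)   ≈⟨ *-congˡ ax≈0 ⟩
    a⁻¹ * 0#        ≈⟨ zeroʳ a⁻¹ ⟩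
    0#              ∎

  module LeadingZeros (x : ℕ → Carrier) (j : ℕ) (g₀⁻¹ : Carrier)
                      (leading : ∀ e → e < j → x e ≈ 0#) (pivot : x j * g₀⁻¹ ≈ 1#) where

    g : ℕ → Carrier
    g e = x (j ℕ.+ e)

    g₀-inverse : g 0 * g₀⁻¹ ≈ 1#
    g₀-inverse = trans (*-congʳ (reflexive (≡.cong x (ℕ.+-identityʳ j)))) pivot

    open Reciprocal g g₀⁻¹ public using (coeff; coeff-suc)

    u-convolution : ∀ N → sumℕ (suc N) (λ e → g e * coeff (N ∸ e)) ≈ δ N 0
    u-convolution = Reciprocal.convolution g g₀⁻¹ g₀-inverse

    entry : ℕ → ℕ → Carrier
    entry r c = sumℕ (suc c) (λ b → x (r ℕ.+ b) * coeff (c ∸ b))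

    entry-top : ∀ r c → r ≤ j → entry r c ≈ δ (r ℕ.+ c) j
    entry-top r c r≤j with c <? j ∸ r
    ... | yes c<t = trans (sumℕ-zero (suc c) λ b b≤c → trans (*-congʳ {x = coeff (c ∸ b)} (leading (r ℕ.+ b)
                            (≡.subst (r ℕ.+ b <_) r+t≡j (ℕ.+-monoʳ-< r (ℕ.≤-<-trans (ℕ.≤-pred b≤c) c<t))))) (zeroˡ _))
                          (reflexive (≡.sym (δ-≢ λ e → ℕ.<-irrefl (≡.trans e (≡.sym r+t≡j)) (ℕ.+-monoʳ-< r c<t))))
      where
      r+t≡j : r ℕ.+ (j ∸ r) ≡ j
      r+t≡j = ℕ.m+[n∸m]≡n r≤j
    ... | no c≮t = begin
      entry r c                                      ≡⟨ ≡.cong (λ z → sumℕ z F) (≡.trans (≡.cong suc (≡.sym t+c′≡c)) (≡.sym (ℕ.+-suc t c′))) ⟩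
      sumℕ (t ℕ.+ suc c′) F                          ≈⟨ sumℕ-+ t (suc c′) F ⟩
      sumℕ t F + sumℕ (suc c′) (λ b → F (t ℕ.+ b))
        ≈⟨ +-cong (sumℕ-zero t λ b b<t → trans (*-congʳ {x = coeff (c ∸ b)} (leading (r ℕ.+ b) (≡.subst (r ℕ.+ b <_) r+t≡j (ℕ.+-monoʳ-< r b<t)))) (zeroˡ _))
                  (sumℕ-cong (suc c′) shift) ⟩
      0# + sumℕ (suc c′) (λ b → g b * coeff (c′ ∸ b)) ≈⟨ +-identityˡ _ ⟩
      sumℕ (suc c′) (λ b → g b * coeff (c′ ∸ b))      ≈⟨ u-convolution c′ ⟩
      δ c′ 0                                          ≡⟨ δ-cong {a = c′} {b = 0} (λ e → ≡.trans r+c≡j+c′ (≡.trans (≡.cong (j ℕ.+_) e) (ℕ.+-identityʳ j)))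
                                                                (λ e → ℕ.+-cancelˡ-≡ j c′ 0 (≡.trans (≡.sym r+c≡j+c′) (≡.trans e (≡.sym (ℕ.+-identityʳ j))))) ⟩
      δ (r ℕ.+ c) j                                   ∎
      where
      t = j ∸ r
      r+t≡j : r ℕ.+ t ≡ j
      r+t≡j = ℕ.m+[n∸m]≡n r≤j
      c′ = c ∸ t
      t+c′≡c : t ℕ.+ c′ ≡ c
      t+c′≡c = ℕ.m+[n∸m]≡n (ℕ.≮⇒≥ c≮t)
      F : ℕ → Carrier
      F b = x (r ℕ.+ b) * coeff (c ∸ b)
      r+c≡j+c′ : r ℕ.+ c ≡ j ℕ.+ c′
      r+c≡j+c′ = ≡.trans (≡.cong (r ℕ.+_) (≡.sym t+c′≡c)) (≡.trans (≡.sym (ℕ.+-assoc r t c′)) (≡.cong (ℕ._+ c′) r+t≡j))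
      shift : ∀ b → b < suc c′ → F (t ℕ.+ b) ≈ g b * coeff (c′ ∸ b)
      shift b _ = reflexive (≡.cong₂ _*_ (≡.cong x (≡.trans (≡.sym (ℕ.+-assoc r t b)) (≡.cong (ℕ._+ b) r+t≡j)))
                                         (≡.cong coeff (≡.trans (≡.cong (_∸ (t ℕ.+ b)) (≡.sym t+c′≡c)) (ℕ.[m+n]∸[m+o]≡n∸o t c′ b))))

    entry-bottom : ∀ r c → entry (suc (j ℕ.+ r)) c ≈ - sumℕ (suc r) (λ e → g e * coeff (suc r ℕ.+ c ∸ e))
    entry-bottom r c = +-inverseʳ-unique _ _ (begin
      sumℕ (suc r) G + entry (suc (j ℕ.+ r)) c      ≈⟨ +-congˡ (sumℕ-cong (suc c) shift) ⟩
      sumℕ (suc r) G + sumℕ (suc c) (λ b → G (suc r ℕ.+ b)) ≈⟨ sumℕ-+ (suc r) (suc c) G ⟨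
      sumℕ (suc r ℕ.+ suc c) G                      ≡⟨ ≡.cong (λ z → sumℕ z G) (ℕ.+-suc (suc r) c) ⟩
      sumℕ (suc (suc r ℕ.+ c)) G                    ≈⟨ u-convolution (suc r ℕ.+ c) ⟩
      δ (suc r ℕ.+ c) 0                             ≡⟨ δ-≢ {suc r ℕ.+ c} {0} (λ ()) ⟩
      0#                                            ∎)
      where
      G : ℕ → Carrier
      G e = g e * coeff (suc r ℕ.+ c ∸ e)
      shift : ∀ b → b < suc c → x (suc (j ℕ.+ r) ℕ.+ b) * coeff (c ∸ b) ≈ G (suc r ℕ.+ b)
      shift b _ = reflexive (≡.cong₂ _*_ (≡.cong x (reassoc j r b)) (≡.cong coeff (≡.sym (ℕ.[m+n]∸[m+o]≡n∸o (suc r) c b))))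
        where
        reassoc : ∀ j r b → suc (j ℕ.+ r) ℕ.+ b ≡ j ℕ.+ (suc r ℕ.+ b)
        reassoc = solve-∀

    module TimesToeplitz (p : ℕ) where
      H N : Matrix (suc (j ℕ.+ p))
      H = Hankel (suc (j ℕ.+ p)) x
      N r k = ∑[ b < suc (j ℕ.+ p) ] (H r b * upperToeplitz coeff (toℕ b) (toℕ k))

      det-N : det (suc (j ℕ.+ p)) N ≈ g₀⁻¹ ^ suc (j ℕ.+ p) * det (suc (j ℕ.+ p)) H
      det-N = det-*-upper-triangular (suc (j ℕ.+ p)) H N _ g₀⁻¹
        (λ b k k<b → reflexive (upperToeplitz-> coeff k<b))
        (λ k → reflexive (upperToeplitz-diagonal coeff (toℕ k)))
        (λ r k → refl)

      N-entry : ∀ r k → N r k ≈ entry (toℕ r) (toℕ k)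
      N-entry r k = sum-*-upperToeplitz (suc (j ℕ.+ p)) (toℕ k) (λ b → x (toℕ r ℕ.+ b)) coeff (Fin.toℕ<n k)

      N-top : ∀ i k → toℕ i < suc j → N i k ≈ δ (suc (toℕ i ℕ.+ toℕ k)) (suc j)
      N-top i k i≤j = trans (N-entry i k) (trans (entry-top (toℕ i) (toℕ k) (ℕ.≤-pred i≤j))
        (reflexive (δ-cong {a = toℕ i ℕ.+ toℕ k} {b = j} (≡.cong suc) ℕ.suc-injective)))

      B : Matrix p
      B r s = N (suc j ↑ʳ r) (suc j ↑ʳ s)

      det-H-block : ∃ λ ε → ε * ε ≈ 1# × g₀⁻¹ ^ suc (j ℕ.+ p) * det (suc (j ℕ.+ p)) H ≈ ε * det p B
      det-H-block = ε , ε²≈1 , trans (sym det-N) det-N≈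
        where
        block = det-reversed-identity-block (suc j) p N N-top
        ε : Carrier
        ε = proj₁ block
        ε²≈1 : ε * ε ≈ 1#
        ε²≈1 = proj₁ (proj₂ block)
        det-N≈ : det (suc (j ℕ.+ p)) N ≈ ε * det p B
        det-N≈ = proj₂ (proj₂ block)

    det-hankel-leading-unit : Unit (det (suc j) (Hankel (suc j) x))
    det-hankel-leading-unit = ≡.subst (λ n → Unit (det n (Hankel n x))) (≡.cong suc (ℕ.+-identityʳ j)) unit
      where
      open TimesToeplitz 0
      ε = proj₁ det-H-block
      ε²≈1 = proj₁ (proj₂ det-H-block)
      scaled = proj₂ (proj₂ det-H-block)
      unit : Unit (det (suc (j ℕ.+ 0)) H)
      unit = g₀⁻¹ ^ suc (j ℕ.+ 0) * ε , (begin
        det _ H * (g₀⁻¹ ^ suc (j ℕ.+ 0) * ε)   ≈⟨ *-assoc _ _ _ ⟨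
        det _ H * g₀⁻¹ ^ suc (j ℕ.+ 0) * ε     ≈⟨ *-congʳ (trans (*-comm _ _) scaled) ⟩
        ε * 1# * ε                            ≈⟨ *-congʳ (*-identityʳ ε) ⟩
        ε * ε                                 ≈⟨ ε²≈1 ⟩
        1#                                    ∎)

    y : ℕ → Carrier
    y t = coeff (suc (suc (j ℕ.+ t)))

    module Reduction (m : ℕ) where
      open TimesToeplitz (suc m)

      B-entry : ∀ r s → B r s ≈ - sumℕ (suc (toℕ r)) (λ e → g e * coeff (suc (toℕ r) ℕ.+ suc (j ℕ.+ toℕ s) ∸ e))
      B-entry r s = trans (N-entry (suc j ↑ʳ r) (suc j ↑ʳ s))
        (trans (reflexive (≡.cong₂ entry (Fin.toℕ-↑ʳ (suc j) r) (Fin.toℕ-↑ʳ (suc j) s)))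
               (entry-bottom (toℕ r) (suc (j ℕ.+ toℕ s))))

      Bᵀ-factor : ∀ s r → B r s ≈ ∑[ d < suc m ] (Hankel (suc m) y s d * upperToeplitz (λ e → - g e) (toℕ d) (toℕ r))
      Bᵀ-factor s r = sym (begin
        sumℕ (suc m) (λ d → y (toℕ s ℕ.+ d) * upperToeplitz (λ e → - g e) d (toℕ r))
          ≈⟨ sum-*-upperToeplitz (suc m) (toℕ r) (λ d → y (toℕ s ℕ.+ d)) (λ e → - g e) (Fin.toℕ<n r) ⟩
        sumℕ (suc (toℕ r)) (λ d → y (toℕ s ℕ.+ d) * - g (toℕ r ∸ d))
          ≈⟨ sumℕ-reverse (suc (toℕ r)) (λ d → y (toℕ s ℕ.+ d) * - g (toℕ r ∸ d)) ⟩
        sumℕ (suc (toℕ r)) (λ e → y (toℕ s ℕ.+ (toℕ r ∸ e)) * - g (toℕ r ∸ (toℕ r ∸ e)))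
          ≈⟨ sumℕ-cong (suc (toℕ r)) reindex ⟩
        sumℕ (suc (toℕ r)) (λ e → - (g e * coeff (suc (toℕ r) ℕ.+ suc (j ℕ.+ toℕ s) ∸ e)))
          ≈⟨ sumℕ-neg (suc (toℕ r)) (λ e → g e * coeff (suc (toℕ r) ℕ.+ suc (j ℕ.+ toℕ s) ∸ e)) ⟩
        - sumℕ (suc (toℕ r)) (λ e → g e * coeff (suc (toℕ r) ℕ.+ suc (j ℕ.+ toℕ s) ∸ e))
          ≈⟨ B-entry r s ⟨
        B r s ∎)
        where
        reindex : ∀ e → e < suc (toℕ r) →
          y (toℕ s ℕ.+ (toℕ r ∸ e)) * - g (toℕ r ∸ (toℕ r ∸ e)) ≈ - (g e * coeff (suc (toℕ r) ℕ.+ suc (j ℕ.+ toℕ s) ∸ e))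
        reindex e e≤r = trans (sym (-‿distribʳ-* _ _)) (-‿cong (trans (*-comm _ _)
          (reflexive (≡.cong₂ (λ a b → g a * coeff b) (ℕ.m∸[m∸n]≡n (ℕ.≤-pred e≤r)) (≡.sym (index e (toℕ r) (toℕ s) (ℕ.≤-pred e≤r)))))))
          where
          index : ∀ e r s → e ≤ r → suc r ℕ.+ suc (j ℕ.+ s) ∸ e ≡ suc (suc (j ℕ.+ (s ℕ.+ (r ∸ e))))
          index e r s e≤r = ≡.trans (≡.cong (λ z → suc z ℕ.+ suc (j ℕ.+ s) ∸ e) (≡.sym (ℕ.m+[n∸m]≡n e≤r)))
                            (≡.trans (≡.cong (_∸ e) (shuffle e (r ∸ e) j s)) (ℕ.m+n∸m≡n e _))
            where
            shuffle : ∀ e d j s → suc (e ℕ.+ d) ℕ.+ suc (j ℕ.+ s) ≡ e ℕ.+ suc (suc (j ℕ.+ (s ℕ.+ d)))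
            shuffle = solve-∀

      det-B : det (suc m) B ≈ (- g 0) ^ suc m * det (suc m) (Hankel (suc m) y)
      det-B = trans (sym (det-transpose (suc m) B))
        (det-*-upper-triangular (suc m) (Hankel (suc m) y) (transpose B) _ (- g 0)
          (λ b k k<b → reflexive (upperToeplitz-> (λ e → - g e) k<b))
          (λ k → reflexive (upperToeplitz-diagonal (λ e → - g e) (toℕ k)))
          Bᵀ-factor)

    det-hankel-reduction : ∀ m → ∃ λ c → Unit c ×
      det (suc (j ℕ.+ suc m)) (Hankel (suc (j ℕ.+ suc m)) x) ≈ c * det (suc m) (Hankel (suc m) y)
    det-hankel-reduction m = A⁻¹ * (ε * P) , unit , (begin
      det n H                         ≈⟨ *-identityˡ _ ⟨
      1# * det n H                    ≈⟨ *-congʳ (trans (*-comm _ _) AA⁻¹≈1) ⟨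
      A⁻¹ * A * det n H               ≈⟨ *-assoc _ _ _ ⟩
      A⁻¹ * (A * det n H)             ≈⟨ *-congˡ (trans scaled (*-congˡ (Reduction.det-B m))) ⟩
      A⁻¹ * (ε * (P * det (suc m) Hy)) ≈⟨ solve 4 (λ a e p d → a ⊕ (e ⊕ (p ⊕ d)) ⊜ (a ⊕ (e ⊕ p)) ⊕ d) refl _ _ _ _ ⟩
      A⁻¹ * (ε * P) * det (suc m) Hy  ∎)
      where
      open TimesToeplitz (suc m) using (H; det-H-block)
      ε = proj₁ det-H-block
      ε²≈1 = proj₁ (proj₂ det-H-block)
      scaled = proj₂ (proj₂ det-H-block)
      n = suc (j ℕ.+ suc m)
      Hy = Hankel (suc m) y
      A = g₀⁻¹ ^ n
      P = (- g 0) ^ suc m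
      g₀⁻¹-unit : Unit g₀⁻¹
      g₀⁻¹-unit = g 0 , trans (*-comm _ _) g₀-inverse
      -g₀-unit : Unit (- g 0)
      -g₀-unit = - g₀⁻¹ , trans (sym (-‿distribˡ-* _ _)) (trans (-‿cong (sym (-‿distribʳ-* _ _)))
                                (trans (-‿involutive _) g₀-inverse))
      A⁻¹ = proj₁ (unit-^ n g₀⁻¹-unit)
      AA⁻¹≈1 : A * A⁻¹ ≈ 1#
      AA⁻¹≈1 = proj₂ (unit-^ n g₀⁻¹-unit)
      unit : Unit (A⁻¹ * (ε * P))
      unit = unit-* (A , trans (*-comm _ _) AA⁻¹≈1) (unit-* (ε , ε²≈1) (unit-^ (suc m) -g₀-unit))

indicator : ∀ {a} {A : Set a} → Dec A → ℕ
indicator A? = if does A? then 1 else 0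

indicator-yes : ∀ {a} {A : Set a} (A? : Dec A) → A → indicator A? ≡ 1
indicator-yes (yes _) _ = ≡.refl
indicator-yes (no ¬a) a = ⊥-elim (¬a a)

indicator-no : ∀ {a} {A : Set a} (A? : Dec A) → ¬ A → indicator A? ≡ 0
indicator-no (yes a) ¬a = ⊥-elim (¬a a)
indicator-no (no _)  _  = ≡.refl

indicator-⇔ : ∀ {a b} {A : Set a} {B : Set b} (A? : Dec A) (B? : Dec B) → (A → B) → (B → A) →
  indicator A? ≡ indicator B?
indicator-⇔ (yes a) B? to _    = ≡.sym (indicator-yes B? (to a))
indicator-⇔ (no ¬a) B? _  from = ≡.sym (indicator-no B? (λ b → ¬a (from b)))

indicator-× : ∀ {a b} {A : Set a} {B : Set b} (A? : Dec A) (B? : Dec B) →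
  indicator (A? ×-dec B?) ≡ indicator A? ℕ.* indicator B?
indicator-× (yes _) (yes _) = ≡.refl
indicator-× (yes _) (no _)  = ≡.refl
indicator-× (no _)  _       = ≡.refl

length-filter-∷ : ∀ {a p} {A : Set a} {P : Pred A p} (P? : Decidable P) x xs →
  length (filter P? (x ∷ xs)) ≡ indicator (P? x) ℕ.+ length (filter P? xs)
length-filter-∷ P? x xs with does (P? x)
... | true  = ≡.refl
... | false = ≡.refl

length-filter-map : ∀ {a b p} {A : Set a} {B : Set b} {P : Pred B p} (P? : Decidable P) (g : A → B) xs →
  length (filter P? (map g xs)) ≡ length (filter (λ x → P? (g x)) xs)
length-filter-map P? g []       = ≡.refl
length-filter-map P? g (x ∷ xs) = ≡.trans (length-filter-∷ P? (g x) (map g xs))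
  (≡.trans (≡.cong (indicator (P? (g x)) ℕ.+_) (length-filter-map P? g xs)) (≡.sym (length-filter-∷ (λ x → P? (g x)) x xs)))

module Counting (F : FiniteField) where
  open FiniteField F hiding (zero)
  open import Data.Nat using (_^_)
  open ≡.≡-Reasoning
  open import Algebra.Properties.Semiring.Sum ℕ.+-*-semiring
    using (sum; sum-syntax; sum-cong-≋; ∑-comm; *-distribˡ-sum; *-distribʳ-sum)
  open CommutativeMonoidSum ℕ.+-0-commutativeMonoid using (sum-single)

  q : ℕ
  q = size

  sum-const : ∀ {n} c → ∑[ i < n ] c ≡ n ℕ.* c
  sum-const {zero}  c = ≡.refl
  sum-const {suc n} c = ≡.cong (c ℕ.+_) (sum-const {n} c)

  Seq : Set
  Seq = ℕ → Carrier

  cons : Carrier → Seq → Seq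
  cons c t zero    = c
  cons c t (suc e) = t e

  zeros : Seq
  zeros _ = 0#

  -- count L f sums f over the q^L sequences that vanish from index L on.
  count : ℕ → (Seq → ℕ) → ℕ
  count zero    f = f zeros
  count (suc L) f = ∑[ i < q ] count L (λ t → f (cons (enum i) t))

  DependsOnFirst : ℕ → (Seq → ℕ) → Set
  DependsOnFirst L f = ∀ s s′ → (∀ e → e < L → s e ≈ s′ e) → f s ≡ f s′

  count-cong : ∀ L {f g : Seq → ℕ} → (∀ s → f s ≡ g s) → count L f ≡ count L g
  count-cong zero    f≡g = f≡g zeros
  count-cong (suc L) f≡g = sum-cong-≋ {q} λ i → count-cong L λ t → f≡g (cons (enum i) t)

  count-*ˡ : ∀ L c (f : Seq → ℕ) → count L (λ s → c ℕ.* f s) ≡ c ℕ.* count L f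
  count-*ˡ zero    c f = ≡.refl
  count-*ˡ (suc L) c f = ≡.trans (sum-cong-≋ {q} λ i → count-*ˡ L c _) (≡.sym (*-distribˡ-sum c (λ i → count L (λ t → f (cons (enum i) t)))))

  count-drop : ∀ r L (f : Seq → ℕ) → count (r ℕ.+ L) (λ s → f (λ e → s (r ℕ.+ e))) ≡ q ^ r ℕ.* count L f
  count-drop zero    L f = ≡.sym (ℕ.+-identityʳ _)
  count-drop (suc r) L f = begin
    ∑[ i < q ] count (r ℕ.+ L) (λ s → f (λ e → s (r ℕ.+ e))) ≡⟨ sum-cong-≋ {q} (λ i → count-drop r L f) ⟩
    ∑[ i < q ] (q ^ r ℕ.* count L f)                          ≡⟨ sum-const {q} (q ^ r ℕ.* count L f) ⟩
    q ℕ.* (q ^ r ℕ.* count L f)                               ≡⟨ ℕ.*-assoc q (q ^ r) _ ⟨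
    q ^ suc r ℕ.* count L f                                   ∎

  count-const : ∀ L c → count L (λ _ → c) ≡ q ^ L ℕ.* c
  count-const L c = ≡.trans (≡.cong (λ n → count n (λ _ → c)) (≡.sym (ℕ.+-identityʳ L))) (count-drop L 0 (λ _ → c))

  count-head : ∀ L (f : Seq → ℕ) → DependsOnFirst (suc L) f →
    ∀ c c′ → c ≈ c′ → count L (λ t → f (cons c t)) ≡ count L (λ t → f (cons c′ t))
  count-head L f dep c c′ c≈c′ = count-cong L λ t → dep _ _ λ where
    zero    _ → c≈c′
    (suc e) _ → refl

  sum-indicator : ∀ (X : Carrier → ℕ) → (∀ c c′ → c ≈ c′ → X c ≡ X c′) →
    ∀ c → ∑[ i < q ] (indicator (enum i ≈? c) ℕ.* X (enum i)) ≡ X c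
  sum-indicator X X-cong c = begin
    ∑[ i < q ] (indicator (enum i ≈? c) ℕ.* X (enum i)) ≡⟨ sum-single i₀ others ⟩
    indicator (enum i₀ ≈? c) ℕ.* X (enum i₀)            ≡⟨ ≡.cong (ℕ._* X (enum i₀)) (indicator-yes (enum i₀ ≈? c) enum-i₀≈c) ⟩
    1 ℕ.* X (enum i₀)                                  ≡⟨ ℕ.*-identityˡ _ ⟩
    X (enum i₀)                                        ≡⟨ X-cong _ _ enum-i₀≈c ⟩
    X c                                                ∎
    where
    i₀ = proj₁ (enum-sur c)
    enum-i₀≈c = proj₂ (enum-sur c)
    others : ∀ i → i ≢ i₀ → indicator (enum i ≈? c) ℕ.* X (enum i) ≡ 0
    others i i≢i₀ = ≡.cong (ℕ._* X (enum i)) (indicator-no (enum i ≈? c)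
      (λ e → i≢i₀ (enum-inj i i₀ (trans e (sym enum-i₀≈c)))))

  sum-bijection : ∀ (X : Carrier → ℕ) → (∀ c c′ → c ≈ c′ → X c ≡ X c′) →
    ∀ (ψ φ : Carrier → Carrier) → (∀ c c′ → c ≈ c′ → ψ c ≈ ψ c′) → (∀ c c′ → c ≈ c′ → φ c ≈ φ c′) →
    (∀ c → ψ (φ c) ≈ c) → (∀ c → φ (ψ c) ≈ c) →
    ∑[ i < q ] X (ψ (enum i)) ≡ ∑[ i < q ] X (enum i)
  sum-bijection X X-cong ψ φ ψ-cong φ-cong ψφ φψ = begin
    ∑[ i < q ] X (ψ (enum i))
      ≡⟨ sum-cong-≋ {q} (λ i → ≡.sym (sum-indicator X X-cong (ψ (enum i)))) ⟩
    ∑[ i < q ] ∑[ i′ < q ] (indicator (enum i′ ≈? ψ (enum i)) ℕ.* X (enum i′))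
      ≡⟨ ∑-comm (λ i i′ → indicator (enum i′ ≈? ψ (enum i)) ℕ.* X (enum i′)) ⟩
    ∑[ i′ < q ] ∑[ i < q ] (indicator (enum i′ ≈? ψ (enum i)) ℕ.* X (enum i′))
      ≡⟨ sum-cong-≋ {q} (λ i′ → ≡.sym (*-distribʳ-sum (X (enum i′)) (λ i → indicator (enum i′ ≈? ψ (enum i))))) ⟩
    ∑[ i′ < q ] (∑[ i < q ] indicator (enum i′ ≈? ψ (enum i)) ℕ.* X (enum i′))
      ≡⟨ sum-cong-≋ {q} (λ i′ → ≡.cong (ℕ._* X (enum i′)) (≡.trans (sum-cong-≋ {q} (flip i′)) (unique-preimage (φ (enum i′))))) ⟩
    ∑[ i′ < q ] (1 ℕ.* X (enum i′))
      ≡⟨ sum-cong-≋ {q} (λ i′ → ℕ.*-identityˡ _) ⟩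
    ∑[ i′ < q ] X (enum i′) ∎
    where
    flip : ∀ i′ i → indicator (enum i′ ≈? ψ (enum i)) ≡ indicator (enum i ≈? φ (enum i′))
    flip i′ i = indicator-⇔ (enum i′ ≈? ψ (enum i)) (enum i ≈? φ (enum i′))
      (λ e → trans (sym (φψ (enum i))) (φ-cong _ _ (sym e)))
      (λ e → trans (sym (ψφ (enum i′))) (ψ-cong _ _ (sym e)))
    unique-preimage : ∀ c → ∑[ i < q ] indicator (enum i ≈? c) ≡ 1
    unique-preimage c = ≡.trans (sum-cong-≋ {q} (λ i → ≡.sym (ℕ.*-identityʳ _))) (sum-indicator (λ _ → 1) (λ _ _ _ → ≡.refl) c)

  sum-affine : ∀ (X : Carrier → ℕ) → (∀ c c′ → c ≈ c′ → X c ≡ X c′) →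
    ∀ {α α⁻¹} → α * α⁻¹ ≈ 1# → ∀ b → ∑[ i < q ] X (α * enum i + b) ≡ ∑[ i < q ] X (enum i)
  sum-affine X X-cong {α} {α⁻¹} αα⁻¹≈1 b = sum-bijection X X-cong ψ φ
    (λ c c′ c≈c′ → +-congʳ (*-congˡ c≈c′)) (λ c c′ c≈c′ → *-congˡ (+-congʳ c≈c′)) ψφ φψ
    where
    ψ φ : Carrier → Carrier
    ψ c = α * c + b
    φ c = α⁻¹ * (c - b)
    ψφ : ∀ c → ψ (φ c) ≈ c
    ψφ c = trans (+-congʳ (trans (sym (*-assoc _ _ _)) (trans (*-congʳ αα⁻¹≈1) (*-identityˡ _))))
             (trans (+-assoc _ _ _) (trans (+-congˡ (-‿inverseˡ b)) (+-identityʳ c)))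
    φψ : ∀ c → φ (ψ c) ≈ c
    φψ c = trans (*-congˡ (trans (+-assoc _ _ _) (trans (+-congˡ (-‿inverseʳ b)) (+-identityʳ _))))
             (trans (sym (*-assoc _ _ _)) (trans (*-congʳ (trans (*-comm _ _) αα⁻¹≈1)) (*-identityˡ c)))

  count-triangular : ∀ {α α⁻¹} → α * α⁻¹ ≈ 1# → ∀ L (Φ : Seq → Seq) (β : ℕ → Seq → Carrier) →
    (∀ i t t′ → (∀ e → e < i → t e ≈ t′ e) → β i t ≈ β i t′) →
    (∀ t i → Φ t i ≈ α * t i + β i t) →
    ∀ f → DependsOnFirst L f → count L (λ t → f (Φ t)) ≡ count L f
  count-triangular αα⁻¹≈1 zero    Φ β β-local Φ≈ f dep = dep _ _ λ _ ()
  count-triangular {α} αα⁻¹≈1 (suc L) Φ β β-local Φ≈ f dep = begin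
    ∑[ i < q ] count L (λ t → f (Φ (cons (enum i) t)))
      ≡⟨ sum-cong-≋ {q} (λ i → count-cong L λ t → dep _ _ (head-tail (enum i) t)) ⟩
    ∑[ i < q ] count L (λ t → f (cons (α * enum i + b₀) (Φ-tail (enum i) t)))
      ≡⟨ sum-cong-≋ {q} (λ i → count-triangular αα⁻¹≈1 L (Φ-tail (enum i)) (λ e t → β (suc e) (cons (enum i) t))
           (λ e t t′ t≈t′ → β-local (suc e) _ _ λ where
              zero    _         → refl
              (suc e′) (s≤s e′<e) → t≈t′ e′ e′<e)
           (λ t e → Φ≈ (cons (enum i) t) (suc e))
           (λ w → f (cons (α * enum i + b₀) w))
           (λ s s′ s≈s′ → dep _ _ λ where
              zero    _         → refl
              (suc e) (s≤s e<L) → s≈s′ e e<L)) ⟩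
    ∑[ i < q ] count L (λ w → f (cons (α * enum i + b₀) w))
      ≡⟨ sum-affine (λ c → count L (λ w → f (cons c w))) (count-head L f dep) αα⁻¹≈1 b₀ ⟩
    ∑[ i < q ] count L (λ w → f (cons (enum i) w)) ∎
    where
    b₀ = β 0 zeros
    Φ-tail : Carrier → Seq → Seq
    Φ-tail c t e = Φ (cons c t) (suc e)
    head-tail : ∀ c t e → e < suc L → Φ (cons c t) e ≈ cons (α * c + b₀) (Φ-tail c t) e
    head-tail c t zero    _ = trans (Φ≈ (cons c t) 0) (+-congˡ (β-local 0 _ zeros λ _ ()))
    head-tail c t (suc e) _ = refl

  prepend : ℕ → Seq → Seq → Seq
  prepend zero    a t = t
  prepend (suc k) a t = cons (a 0) (prepend k (λ e → a (suc e)) t)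

  prepend-< : ∀ k a t e → e < k → prepend k a t e ≡ a e
  prepend-< (suc k) a t zero    _         = ≡.refl
  prepend-< (suc k) a t (suc e) (s≤s e<k) = prepend-< k (λ e → a (suc e)) t e e<k

  prepend-+ : ∀ k a t e → prepend k a t (k ℕ.+ e) ≡ t e
  prepend-+ zero    a t e = ≡.refl
  prepend-+ (suc k) a t e = prepend-+ k (λ e → a (suc e)) t e

  prepend-drop : ∀ j k a t e → prepend (j ℕ.+ k) a t (j ℕ.+ e) ≡ prepend k (λ e → a (j ℕ.+ e)) t e
  prepend-drop zero    k a t e = ≡.refl
  prepend-drop (suc j) k a t e = prepend-drop j k (λ e → a (suc e)) t e

  prepend-cons : ∀ k a c t e → prepend k a (cons c t) e ≡ prepend (suc k) (prepend k a (λ _ → c)) t e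
  prepend-cons zero    a c t zero    = ≡.refl
  prepend-cons zero    a c t (suc e) = ≡.refl
  prepend-cons (suc k) a c t zero    = ≡.refl
  prepend-cons (suc k) a c t (suc e) = prepend-cons k (λ e → a (suc e)) c t e

  prepend-cong : ∀ k a t t′ i → (∀ e → e < i → t e ≈ t′ e) → ∀ e → e < k ℕ.+ i → prepend k a t e ≈ prepend k a t′ e
  prepend-cong zero    a t t′ i t≈t′ e       e<i          = t≈t′ e e<i
  prepend-cong (suc k) a t t′ i t≈t′ zero    _            = refl
  prepend-cong (suc k) a t t′ i t≈t′ (suc e) (s≤s e<k+i) = prepend-cong k (λ e → a (suc e)) t t′ i t≈t′ e e<k+i

  HasPrefix : ℕ → Seq → Seq → Set
  HasPrefix k a s = ∀ e → e < k → s e ≈ a e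

  hasPrefix? : ∀ k a s → Dec (HasPrefix k a s)
  hasPrefix? zero    a s = yes λ _ ()
  hasPrefix? (suc k) a s with s 0 ≈? a 0 | hasPrefix? k (λ e → a (suc e)) (λ e → s (suc e))
  ... | yes s₀≈a₀ | yes rest = yes λ where
    zero    _         → s₀≈a₀
    (suc e) (s≤s e<k) → rest e e<k
  ... | no s₀≉a₀  | _        = no λ prefix → s₀≉a₀ (prefix 0 (s≤s z≤n))
  ... | yes _     | no ¬rest = no λ prefix → ¬rest (λ e e<k → prefix (suc e) (s≤s e<k))

  indicator-hasPrefix-cons : ∀ k a c t → indicator (hasPrefix? (suc k) a (cons c t)) ≡
    indicator (c ≈? a 0) ℕ.* indicator (hasPrefix? k (λ e → a (suc e)) t)
  indicator-hasPrefix-cons k a c t with c ≈? a 0 | hasPrefix? k (λ e → a (suc e)) t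
  ... | yes _ | yes _ = ≡.refl
  ... | yes _ | no _  = ≡.refl
  ... | no _  | _     = ≡.refl

  count-prefix : ∀ k L a (h : Seq → ℕ) → DependsOnFirst (k ℕ.+ L) h →
    count (k ℕ.+ L) (λ s → indicator (hasPrefix? k a s) ℕ.* h s) ≡ count L (λ t → h (prepend k a t))
  count-prefix zero    L a h dep = count-cong L λ s → ℕ.+-identityʳ (h s)
  count-prefix (suc k) L a h dep = begin
    ∑[ i < q ] count (k ℕ.+ L) (λ t → indicator (hasPrefix? (suc k) a (cons (enum i) t)) ℕ.* h (cons (enum i) t))
      ≡⟨ sum-cong-≋ {q} (λ i → ≡.trans (count-cong (k ℕ.+ L) λ t →
           ≡.trans (≡.cong (ℕ._* h (cons (enum i) t)) (indicator-hasPrefix-cons k a (enum i) t))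
                   (ℕ.*-assoc (indicator (enum i ≈? a 0)) _ _))
           (count-*ˡ (k ℕ.+ L) (indicator (enum i ≈? a 0)) _)) ⟩
    ∑[ i < q ] (indicator (enum i ≈? a 0) ℕ.* X (enum i))   ≡⟨ sum-indicator X X-cong (a 0) ⟩
    X (a 0)                                                  ≡⟨ count-prefix k L (λ e → a (suc e)) (λ t → h (cons (a 0) t)) dep-tail ⟩
    count L (λ t → h (prepend (suc k) a t))                  ∎
    where
    X : Carrier → ℕ
    X c = count (k ℕ.+ L) (λ t → indicator (hasPrefix? k (λ e → a (suc e)) t) ℕ.* h (cons c t))
    X-cong : ∀ c c′ → c ≈ c′ → X c ≡ X c′
    X-cong c c′ c≈c′ = count-cong (k ℕ.+ L) λ t → ≡.cong (indicator (hasPrefix? k (λ e → a (suc e)) t) ℕ.*_)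
      (dep _ _ λ where
        zero    _ → c≈c′
        (suc e) _ → refl)
    dep-tail : DependsOnFirst (k ℕ.+ L) (λ t → h (cons (a 0) t))
    dep-tail s s′ s≈s′ = dep _ _ λ where
      zero    _             → refl
      (suc e) (s≤s e<k+L) → s≈s′ e e<k+L

  length-filter-concatMap : ∀ {A : Set} {P : Pred A ℓ₀} (P? : Decidable P) {n} (G : Fin q → List A) (f : Fin n → Fin q) →
    length (filter P? (concatMap G (tabulate f))) ≡ ∑[ i < n ] length (filter P? (G (f i)))
  length-filter-concatMap P? {zero}  G f = ≡.refl
  length-filter-concatMap P? {suc n} G f = begin
    length (filter P? (G (f zero) ++ concatMap G (tabulate (λ i → f (suc i)))))
      ≡⟨ ≡.cong length (List.filter-++ P? (G (f zero)) _) ⟩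
    length (filter P? (G (f zero)) ++ filter P? (concatMap G (tabulate (λ i → f (suc i)))))
      ≡⟨ List.length-++ (filter P? (G (f zero))) ⟩
    length (filter P? (G (f zero))) ℕ.+ length (filter P? (concatMap G (tabulate (λ i → f (suc i)))))
      ≡⟨ ≡.cong (length (filter P? (G (f zero))) ℕ.+_) (length-filter-concatMap P? G (λ i → f (suc i))) ⟩
    ∑[ i < suc n ] length (filter P? (G (f i))) ∎

  RespectsPointwise : ∀ {m} → ((Fin m → Carrier) → Set) → Set
  RespectsPointwise P = ∀ x y → (∀ i → x i ≈ y i) → P x → P y

  length-filter-allFuns : ∀ m (P : (Fin m → Carrier) → Set) (P? : Decidable P) → RespectsPointwise P →
    length (filter (λ c → P? (λ t → enum (c t))) (allFuns m q)) ≡ count m (λ s → indicator (P? (λ t → s (toℕ t))))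
  length-filter-allFuns zero    P P? resp = ≡.trans (length-filter-∷ (λ c → P? (λ t → enum (c t))) (λ ()) []) (≡.trans (ℕ.+-identityʳ _) (indicator-⇔ (P? _) (P? _) (resp _ _ λ ()) (resp _ _ λ ())))
  length-filter-allFuns (suc m) P P? resp = begin
    length (filter P′? (concatMap (λ i → map (i ∷ᵥ_) (allFuns m q)) (allFin q)))
      ≡⟨ length-filter-concatMap P′? (λ i → map (i ∷ᵥ_) (allFuns m q)) (λ i → i) ⟩
    ∑[ i < q ] length (filter P′? (map (i ∷ᵥ_) (allFuns m q)))
      ≡⟨ sum-cong-≋ {q} (λ i → ≡.trans (length-filter-map P′? (i ∷ᵥ_) (allFuns m q))
           (≡.cong length (List.filter-≐ _ _ (head-enum i) (allFuns m q)))) ⟩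
    ∑[ i < q ] length (filter (λ c → P? (enum i ∷ᵥ (λ t → enum (c t)))) (allFuns m q))
      ≡⟨ sum-cong-≋ {q} (λ i → ≡.trans (length-filter-allFuns m (λ v → P (enum i ∷ᵥ v)) (λ v → P? (enum i ∷ᵥ v))
             (λ x y x≈y → resp _ _ (∷-cong x≈y)))
           (count-cong m λ s → indicator-⇔ (P? _) (P? _) (resp _ _ (cons-toℕ i s)) (resp _ _ (λ t → sym (cons-toℕ i s t))))) ⟩
    ∑[ i < q ] count m (λ s → indicator (P? (λ t → cons (enum i) s (toℕ t)))) ∎
    where
    P′? : Decidable (λ c → P (λ t → enum (c t)))
    P′? c = P? (λ t → enum (c t))
    enum-∷ : ∀ i (c : Fin m → Fin q) t → enum ((i ∷ᵥ c) t) ≈ (enum i ∷ᵥ (λ t → enum (c t))) t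
    enum-∷ i c zero    = refl
    enum-∷ i c (suc t) = refl
    head-enum : ∀ i → (λ c → P (λ t → enum ((i ∷ᵥ c) t))) ≐ (λ c → P (enum i ∷ᵥ (λ t → enum (c t))))
    head-enum i = (λ {c} → resp _ _ (enum-∷ i c)) , (λ {c} → resp _ _ (λ t → sym (enum-∷ i c t)))
    ∷-cong : ∀ {c x y} → (∀ i → x i ≈ y i) → ∀ (t : Fin (suc m)) → (c ∷ᵥ x) t ≈ (c ∷ᵥ y) t
    ∷-cong x≈y zero    = refl
    ∷-cong x≈y (suc t) = x≈y t
    cons-toℕ : ∀ i s (t : Fin (suc m)) → (enum i ∷ᵥ (λ t → s (toℕ t))) t ≈ cons (enum i) s (toℕ t)
    cons-toℕ i s zero    = refl
    cons-toℕ i s (suc t) = refl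

module HankelCount (F : FiniteField) where
  open FiniteField F hiding (zero)
  open import Data.Nat using (_^_)
  open Counting F
  open Determinant commRing using (det; det-cong; det-zero-first-row)
  open HankelReduction commRing using (Hankel; Unit; unit-cancel; module LeadingZeros)
  open import Algebra.Properties.Semiring.Sum ℕ.+-*-semiring using (sum-cong-≋; sum-syntax)

  singular? : ∀ n (s : Seq) → Dec (det (suc n) (Hankel (suc n) s) ≈ 0#)
  singular? n s = det (suc n) (Hankel (suc n) s) ≈? 0#

  singular : ℕ → Seq → ℕ
  singular n s = indicator (singular? n s)

  singular-local : ∀ n → DependsOnFirst (suc (2 ℕ.* n)) (singular n)
  singular-local n s s′ s≈s′ = indicator-⇔ (singular? n s) (singular? n s′)
    (λ det≈0 → trans (sym (det-cong (suc n) entries)) det≈0) (λ det≈0 → trans (det-cong (suc n) entries) det≈0)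
    where
    entries : ∀ r c → Hankel (suc n) s r c ≈ Hankel (suc n) s′ r c
    entries r c = s≈s′ _ (s≤s (≡.subst (toℕ r ℕ.+ toℕ c ≤_) (≡.cong (n ℕ.+_) (≡.sym (ℕ.+-identityʳ n)))
                    (ℕ.+-mono-≤ (ℕ.≤-pred (Fin.toℕ<n r)) (ℕ.≤-pred (Fin.toℕ<n c)))))

  singular-cong : ∀ n s s′ → (∀ e → s e ≈ s′ e) → singular n s ≡ singular n s′
  singular-cong n s s′ s≈s′ = singular-local n s s′ (λ e _ → s≈s′ e)

  first-nonzero : ∀ k (a : Seq) →
    (∃ λ j → j < k × (∀ e → e < j → a e ≈ 0#) × ¬ (a j ≈ 0#)) ⊎ (∀ e → e < k → a e ≈ 0#)
  first-nonzero zero    a = inj₂ λ _ ()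
  first-nonzero (suc k) a with first-nonzero k a
  ... | inj₁ (j , j<k , zeros-below , a-j≉0) = inj₁ (j , ℕ.m<n⇒m<1+n j<k , zeros-below , a-j≉0)
  ... | inj₂ below-k with a k ≈? 0#
  ...   | no a-k≉0 = inj₁ (k , ℕ.n<1+n k , below-k , a-k≉0)
  ...   | yes a-k≈0 = inj₂ λ e e<1+k → case (ℕ.m<1+n⇒m<n∨m≡n e<1+k)
    where
    case : ∀ {e} → e < k ⊎ e ≡ k → a e ≈ 0#
    case (inj₁ e<k)   = below-k _ e<k
    case (inj₂ ≡.refl) = a-k≈0

  singular-zero-row : ∀ n s → (∀ e → e ≤ n → s e ≈ 0#) → singular n s ≡ 1
  singular-zero-row n s row≈0 = indicator-yes (singular? n s)
    (det-zero-first-row n (Hankel (suc n) s) λ c → row≈0 (toℕ c) (ℕ.≤-pred (Fin.toℕ<n c)))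

  nonsingular-leading : ∀ n s {s⁻¹} → (∀ e → e < n → s e ≈ 0#) → s n * s⁻¹ ≈ 1# → singular n s ≡ 0
  nonsingular-leading n s leading pivot = indicator-no (singular? n s) λ det≈0 →
    0≉1 (trans (sym (trans (*-congʳ det≈0) (zeroˡ _))) (proj₂ (LeadingZeros.det-hankel-leading-unit s n _ leading pivot)))

  count-zero-prefix : ∀ n a → (∀ e → e < n → a e ≈ 0#) → count (suc n) (λ t → singular n (prepend n a t)) ≡ q ^ n
  count-zero-prefix n a a≈0 = begin
    ∑[ i < q ] count n (λ t → singular n (x (enum i) t))        ≡⟨ sum-cong-≋ {q} term ⟩
    ∑[ i < q ] (indicator (enum i ≈? 0#) ℕ.* q ^ n)           ≡⟨ sum-indicator (λ _ → q ^ n) (λ _ _ _ → ≡.refl) 0# ⟩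
    q ^ n                                                    ∎
    where
    open ≡.≡-Reasoning
    x : Carrier → Seq → Seq
    x c t = prepend n a (cons c t)
    x-below : ∀ c t e → e < n → x c t e ≈ 0#
    x-below c t e e<n = trans (reflexive (prepend-< n a _ e e<n)) (a≈0 e e<n)
    x-at : ∀ c t → x c t n ≡ c
    x-at c t = ≡.trans (≡.cong (x c t) (≡.sym (ℕ.+-identityʳ n))) (prepend-+ n a (cons c t) 0)
    x-row : ∀ c t → c ≈ 0# → ∀ e → e ≤ n → x c t e ≈ 0#
    x-row c t c≈0 e e≤n with ℕ.m≤n⇒m<n∨m≡n e≤n
    ... | inj₁ e<n    = x-below c t e e<n
    ... | inj₂ ≡.refl = trans (reflexive (x-at c t)) c≈0
    term : ∀ i → count n (λ t → singular n (x (enum i) t)) ≡ indicator (enum i ≈? 0#) ℕ.* q ^ n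
    term i with enum i ≈? 0#
    ... | yes enum-i≈0 = ≡.trans (count-cong n λ t → singular-zero-row n _ (x-row (enum i) t enum-i≈0))
                                 (≡.trans (count-const n 1) (≡.trans (ℕ.*-identityʳ _) (≡.sym (ℕ.+-identityʳ _))))
    ... | no enum-i≉0  = ≡.trans (count-cong n λ t → nonsingular-leading n _ (x-below (enum i) t)
                                   (trans (*-congʳ (reflexive (x-at (enum i) t))) (proj₂ (inverse _ enum-i≉0))))
                                 (≡.trans (count-const n 0) (ℕ.*-zeroʳ (q ^ n)))

  count-next : ∀ n k L a → count (suc L) (λ t → singular n (prepend k a t)) ≡
    ∑[ i < q ] count L (λ t → singular n (prepend (suc k) (prepend k a (λ _ → enum i)) t))
  count-next n k L a = sum-cong-≋ {q} λ i → count-cong L λ t →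
    singular-cong n _ _ λ e → reflexive (prepend-cons k a (enum i) t e)

  ExtensionCount : ℕ → Set
  ExtensionCount n = ∀ k L a → k ℕ.+ suc L ≡ suc (2 ℕ.* n) → k ≤ n →
    count (suc L) (λ t → singular n (prepend k a t)) ≡ q ^ L

  module LeadingNonzero (j k0 d : ℕ) (a : Seq) (zeros-below : ∀ e → e < j → a e ≈ 0#) (a-j≉0 : ¬ (a j ≈ 0#)) where
    open import Algebra.Properties.Ring ring using (-‿distribˡ-*; -‿distribʳ-*; -‿involutive; -‿+-comm)
    open import Algebra.Solver.CommutativeMonoid *-commutativeMonoid using (solve; _⊕_; _⊜_)
    open HankelReduction commRing using (module Reciprocal; reciprocal-local; sumℕ; sumℕ-cong; sumℕ-last)

    m n k′ k L : ℕ
    m  = k0 ℕ.+ d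
    n  = j ℕ.+ suc m
    k′ = suc k0
    k  = j ℕ.+ k′
    L  = suc (j ℕ.+ (k0 ℕ.+ (d ℕ.+ d)))

    a-j⁻¹ : Carrier
    a-j⁻¹ = proj₁ (inverse (a j) a-j≉0)

    b : Seq
    b e = a (j ℕ.+ e)

    -- u t is the inverse of the power series with coefficients a_j, …, a_{j+k0}, t₀, t₁, …;
    -- its first k′ coefficients c do not depend on t and the later ones Φ t are triangular in t.
    u : Seq → Seq
    u t = Reciprocal.coeff (prepend k′ b t) a-j⁻¹

    c : Seq
    c = u zeros

    Φ : Seq → Seq
    Φ t i = u t (k′ ℕ.+ i)

    u-split : ∀ t e → u t e ≈ prepend k′ c (Φ t) e
    u-split t e with e ℕ.<? k′
    ... | yes e<k′ = trans (reciprocal-local _ _ a-j⁻¹ e (λ e′ e′≤e → reflexive (≡.trans (prepend-< k′ b t e′ (ℕ.≤-<-trans e′≤e e<k′))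
                                                                    (≡.sym (prepend-< k′ b zeros e′ (ℕ.≤-<-trans e′≤e e<k′))))) e ℕ.≤-refl)
                           (reflexive (≡.sym (prepend-< k′ c (Φ t) e e<k′)))
    ... | no e≮k′  = ≡.subst (λ i → u t i ≈ prepend k′ c (Φ t) i) (ℕ.m+[n∸m]≡n (ℕ.≮⇒≥ e≮k′))
                       (reflexive (≡.sym (prepend-+ k′ c (Φ t) (e ∸ k′))))

    reduced : Seq → ℕ
    reduced w = singular m (λ t′ → prepend k′ c w (suc (suc (j ℕ.+ t′))))

    singular-reduced : ∀ t → singular n (prepend k a t) ≡ reduced (Φ t)
    singular-reduced t = ≡.trans (indicator-⇔ (singular? n x) (singular? m y)
        (λ det≈0 → unit-cancel _ unit (trans (sym reduction) det≈0))
        (λ det≈0 → trans reduction (trans (*-congˡ det≈0) (zeroʳ _))))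
      (singular-cong m _ _ y≈)
      where
      x = prepend k a t
      leading : ∀ e → e < j → x e ≈ 0#
      leading e e<j = trans (reflexive (prepend-< k a t e (ℕ.<-≤-trans e<j (ℕ.m≤m+n j k′)))) (zeros-below e e<j)
      pivot : x j * a-j⁻¹ ≈ 1#
      pivot = trans (*-congʳ (reflexive (prepend-< k a t j (ℕ.m<m+n j (s≤s z≤n))))) (proj₂ (inverse (a j) a-j≉0))
      open LeadingZeros x j a-j⁻¹ leading pivot using (y; det-hankel-reduction)
      unit = proj₁ (proj₂ (det-hankel-reduction m))
      reduction = proj₂ (proj₂ (det-hankel-reduction m))
      y≈ : ∀ t′ → y t′ ≈ prepend k′ c (Φ t) (suc (suc (j ℕ.+ t′)))
      y≈ t′ = trans (reciprocal-local (λ e → x (j ℕ.+ e)) (prepend k′ b t) a-j⁻¹ i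
                       (λ e _ → reflexive (prepend-drop j k′ a t e)) i ℕ.≤-refl)
                    (u-split t i)
        where
        i = suc (suc (j ℕ.+ t′))

    α α⁻¹ : Carrier
    α   = - (a-j⁻¹ * a-j⁻¹)
    α⁻¹ = - (a j * a j)

    αα⁻¹≈1 : α * α⁻¹ ≈ 1#
    αα⁻¹≈1 = trans (sym (-‿distribˡ-* _ _)) (trans (-‿cong (sym (-‿distribʳ-* _ _))) (trans (-‿involutive _)
      (trans (solve 2 (λ g a → (g ⊕ g) ⊕ (a ⊕ a) ⊜ (a ⊕ g) ⊕ (a ⊕ g)) refl a-j⁻¹ (a j))
             (trans (*-cong a-j-inverse a-j-inverse) (*-identityˡ 1#)))))
      where
      a-j-inverse = proj₂ (inverse (a j) a-j≉0)

    β : ℕ → Seq → Carrier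
    β i t = - (a-j⁻¹ * sumℕ (k0 ℕ.+ i) (λ e → prepend k′ b t (suc e) * u t (k0 ℕ.+ i ∸ e)))

    Φ-triangular : ∀ t i → Φ t i ≈ α * t i + β i t
    Φ-triangular t i = begin
      u t (suc M)                                        ≈⟨ Reciprocal.coeff-suc (prepend k′ b t) a-j⁻¹ M ⟩
      - (a-j⁻¹ * sumℕ (suc M) h)                         ≈⟨ -‿cong (*-congˡ (sumℕ-last M h)) ⟩
      - (a-j⁻¹ * (sumℕ M h + h M))                       ≈⟨ -‿cong (*-congˡ (+-congˡ (*-cong (reflexive (prepend-+ k0 (λ e → b (suc e)) t i))
                                                                                      (reflexive (≡.cong (u t) (ℕ.n∸n≡0 M)))))) ⟩
      - (a-j⁻¹ * (sumℕ M h + t i * a-j⁻¹))               ≈⟨ -‿cong (distribˡ _ _ _) ⟩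
      - (a-j⁻¹ * sumℕ M h + a-j⁻¹ * (t i * a-j⁻¹))       ≈⟨ -‿+-comm _ _ ⟨
      β i t + - (a-j⁻¹ * (t i * a-j⁻¹))                  ≈⟨ +-comm _ _ ⟩
      - (a-j⁻¹ * (t i * a-j⁻¹)) + β i t                  ≈⟨ +-congʳ (trans (-‿cong (solve 2 (λ g x → g ⊕ (x ⊕ g) ⊜ (g ⊕ g) ⊕ x) refl a-j⁻¹ (t i)))
                                                                          (-‿distribˡ-* _ _)) ⟩
      α * t i + β i t                                    ∎
      where
      open import Relation.Binary.Reasoning.Setoid setoid
      M = k0 ℕ.+ i
      h : ℕ → Carrier
      h e = prepend k′ b t (suc e) * u t (M ∸ e)

    β-local : ∀ i t t′ → (∀ e → e < i → t e ≈ t′ e) → β i t ≈ β i t′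
    β-local i t t′ t≈t′ = -‿cong (*-congˡ (sumℕ-cong (k0 ℕ.+ i) λ e e<k0+i →
      *-cong (prepend-cong k′ b t t′ i t≈t′ (suc e) (s≤s e<k0+i))
             (reciprocal-local _ _ a-j⁻¹ (k0 ℕ.+ i) (λ e′ e′≤k0+i → prepend-cong k′ b t t′ i t≈t′ e′ (s≤s e′≤k0+i)) _ (ℕ.m∸n≤m _ e))))

    reduced-local : DependsOnFirst (suc L) reduced
    reduced-local w w′ w≈w′ = singular-local m _ _ λ t′ t′<1+2m →
      prepend-cong k′ c w w′ (suc L) w≈w′ _ (≡.subst (suc (suc (j ℕ.+ t′)) <_) (≡.sym (window-end j k0 d))
        (s≤s (s≤s (s≤s (ℕ.+-monoʳ-≤ j (ℕ.≤-pred t′<1+2m))))))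
      where
      window-end : ∀ j k0 d → suc k0 ℕ.+ suc (suc (j ℕ.+ (k0 ℕ.+ (d ℕ.+ d)))) ≡
                             suc (suc (suc (j ℕ.+ ((k0 ℕ.+ d) ℕ.+ ((k0 ℕ.+ d) ℕ.+ 0)))))
      window-end = solve-∀

    count-reduced : count (suc L) (λ t → singular n (prepend k a t)) ≡ count (suc L) reduced
    count-reduced = ≡.trans (count-cong (suc L) singular-reduced)
      (count-triangular αα⁻¹≈1 (suc L) Φ β β-local Φ-triangular reduced reduced-local)

    count-short-prefix : ExtensionCount m → k0 ≤ suc j → count (suc L) reduced ≡ q ^ L
    count-short-prefix IH k0≤1+j = begin
      count (suc L) reduced                                        ≡⟨ count-cong (suc L) (λ w → singular-cong m _ _ (shift w)) ⟩
      count (suc L) (λ w → singular m (λ t′ → w (r ℕ.+ t′)))       ≡⟨ ≡.cong (λ l → count l (λ w → singular m (λ t′ → w (r ℕ.+ t′)))) 1+L≡r+1+2m ⟩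
      count (r ℕ.+ suc (2 ℕ.* m)) (λ w → singular m (λ t′ → w (r ℕ.+ t′))) ≡⟨ count-drop r (suc (2 ℕ.* m)) (singular m) ⟩
      q ^ r ℕ.* count (suc (2 ℕ.* m)) (singular m)                 ≡⟨ ≡.cong (q ^ r ℕ.*_) (IH 0 (2 ℕ.* m) zeros ≡.refl z≤n) ⟩
      q ^ r ℕ.* q ^ (2 ℕ.* m)                                      ≡⟨ ℕ.^-distribˡ-+-* q r (2 ℕ.* m) ⟨
      q ^ (r ℕ.+ 2 ℕ.* m)                                          ≡⟨ ≡.cong (q ^_) L≡r+2m ⟨
      q ^ L                                                        ∎
      where
      open ≡.≡-Reasoning
      r = suc j ∸ k0
      k0+r≡1+j : k0 ℕ.+ r ≡ suc j
      k0+r≡1+j = ℕ.m+[n∸m]≡n k0≤1+j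
      shift : ∀ w t′ → prepend k′ c w (suc (suc (j ℕ.+ t′))) ≈ w (r ℕ.+ t′)
      shift w t′ = reflexive (≡.trans (≡.cong (prepend k′ c w) (≡.cong suc (≡.sym
        (≡.trans (≡.sym (ℕ.+-assoc k0 r t′)) (≡.cong (ℕ._+ t′) k0+r≡1+j))))) (prepend-+ k′ c w (r ℕ.+ t′)))
      L≡r+2m : L ≡ r ℕ.+ 2 ℕ.* m
      L≡r+2m = ℕ.+-cancelˡ-≡ k0 L (r ℕ.+ 2 ℕ.* m) (≡.trans (tail-length j k0 d)
        (≡.trans (≡.cong (ℕ._+ 2 ℕ.* m) (≡.sym k0+r≡1+j)) (ℕ.+-assoc k0 r (2 ℕ.* m))))
        where
        tail-length : ∀ j k0 d → k0 ℕ.+ suc (j ℕ.+ (k0 ℕ.+ (d ℕ.+ d))) ≡ suc j ℕ.+ 2 ℕ.* (k0 ℕ.+ d)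
        tail-length = solve-∀
      1+L≡r+1+2m : suc L ≡ r ℕ.+ suc (2 ℕ.* m)
      1+L≡r+1+2m = ≡.trans (≡.cong suc L≡r+2m) (≡.sym (ℕ.+-suc r (2 ℕ.* m)))

    count-long-prefix : ExtensionCount m → suc j < k0 → count (suc L) reduced ≡ q ^ L
    count-long-prefix IH 1+j<k0 = ≡.trans (count-cong (suc L) λ w → singular-cong m _ _ (shift w))
                                           (IH k″ L c″ shorter-total k″≤m)
      where
      k″ = k0 ∸ suc j
      k0≡ : suc j ℕ.+ k″ ≡ k0
      k0≡ = ℕ.m+[n∸m]≡n (ℕ.<⇒≤ 1+j<k0)
      c″ : Seq
      c″ e = c (suc (suc j) ℕ.+ e)
      k″≤m : k″ ≤ m
      k″≤m = ℕ.≤-trans (ℕ.m∸n≤m k0 (suc j)) (ℕ.m≤m+n k0 d)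
      shift : ∀ w t′ → prepend k′ c w (suc (suc (j ℕ.+ t′))) ≈ prepend k″ c″ w t′
      shift w t′ = reflexive (≡.subst (λ l → prepend (suc l) c w (suc (suc (j ℕ.+ t′))) ≡ prepend k″ c″ w t′) k0≡
        (prepend-drop (suc (suc j)) k″ c w t′))
      shorter-total : k″ ℕ.+ suc L ≡ suc (2 ℕ.* m)
      shorter-total = ≡.subst (λ z → k″ ℕ.+ suc (suc (j ℕ.+ (z ℕ.+ (d ℕ.+ d)))) ≡ suc (2 ℕ.* (z ℕ.+ d))) k0≡
                                 (tail-length j k″ d)
        where
        tail-length : ∀ j k″ d → k″ ℕ.+ suc (suc (j ℕ.+ ((suc j ℕ.+ k″) ℕ.+ (d ℕ.+ d)))) ≡ suc (2 ℕ.* ((suc j ℕ.+ k″) ℕ.+ d))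
        tail-length = solve-∀

  count-leading-nonzero : ∀ n k L a j → j < k → k ≤ n → k ℕ.+ suc L ≡ suc (2 ℕ.* n) →
    (∀ e → e < j → a e ≈ 0#) → ¬ (a j ≈ 0#) → (∀ {m} → m < n → ExtensionCount m) →
    count (suc L) (λ t → singular n (prepend k a t)) ≡ q ^ L
  -- The with-chain brings k, n and L into the shapes fixed by LeadingNonzero j k0 d.
  count-leading-nonzero n k L a j j<k k≤n total below a-j≉0 IH
    with k ∸ suc j | ℕ.m+[n∸m]≡n j<k
  ... | k0 | 1+j+k0≡k with ≡.trans (ℕ.+-suc j k0) 1+j+k0≡k
  ... | ≡.refl with n ∸ (j ℕ.+ suc k0) | ℕ.m+[n∸m]≡n k≤n
  ... | d | k+d≡n with ≡.trans (≡.sym (ℕ.+-assoc j (suc k0) d)) k+d≡n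
  ... | ≡.refl with L-eq
    where
    L-eq : suc (j ℕ.+ (k0 ℕ.+ (d ℕ.+ d))) ≡ L
    L-eq = ℕ.suc-injective (ℕ.+-cancelˡ-≡ (j ℕ.+ suc k0) _ _ (≡.trans (tail-length j k0 d) (≡.sym total)))
      where
      tail-length : ∀ j k0 d → (j ℕ.+ suc k0) ℕ.+ suc (suc (j ℕ.+ (k0 ℕ.+ (d ℕ.+ d)))) ≡ suc (2 ℕ.* (j ℕ.+ suc (k0 ℕ.+ d)))
      tail-length = solve-∀
  ... | ≡.refl = ≡.trans count-reduced (case (k0 ℕ.≤? suc j))
    where
    open LeadingNonzero j k0 d a below a-j≉0 hiding (k; n; L)
    IH-m : ExtensionCount m
    IH-m = IH (ℕ.m≤n+m (suc m) j)
    case : Dec (k0 ≤ suc j) → count (suc (suc (j ℕ.+ (k0 ℕ.+ (d ℕ.+ d))))) reduced ≡ q ^ suc (j ℕ.+ (k0 ℕ.+ (d ℕ.+ d)))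
    case (yes k0≤1+j) = count-short-prefix IH-m k0≤1+j
    case (no k0≰1+j)  = count-long-prefix IH-m (ℕ.≰⇒> k0≰1+j)

  mutual
    count-from-prefix : ∀ n → (∀ {m} → m < n → ExtensionCount m) → ∀ d k L a → k ℕ.+ d ≡ n →
      k ℕ.+ suc L ≡ suc (2 ℕ.* n) → count (suc L) (λ t → singular n (prepend k a t)) ≡ q ^ L
    count-from-prefix n IH d k L a k+d≡n total with first-nonzero k a
    ... | inj₁ (j , j<k , below , a-j≉0) =
      count-leading-nonzero n k L a j j<k (≡.subst (k ≤_) k+d≡n (ℕ.m≤m+n k d)) total below a-j≉0 IH
    ... | inj₂ all-zero = count-from-zero-prefix n IH d k L a k+d≡n total all-zero

    count-from-zero-prefix : ∀ n → (∀ {m} → m < n → ExtensionCount m) → ∀ d k L a → k ℕ.+ d ≡ n →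
      k ℕ.+ suc L ≡ suc (2 ℕ.* n) → (∀ e → e < k → a e ≈ 0#) →
      count (suc L) (λ t → singular n (prepend k a t)) ≡ q ^ L
    count-from-zero-prefix n IH zero k L a k+0≡n total all-zero with ≡.trans (≡.sym (ℕ.+-identityʳ k)) k+0≡n
    ... | ≡.refl with L≡n
      where
      L≡n : L ≡ n
      L≡n = ℕ.+-cancelˡ-≡ n L n (ℕ.suc-injective
        (≡.trans (≡.sym (ℕ.+-suc n L)) (≡.trans total (≡.cong (λ z → suc (n ℕ.+ z)) (ℕ.+-identityʳ n)))))
    ... | ≡.refl = count-zero-prefix k a all-zero
    count-from-zero-prefix n IH (suc d) k zero a k+1+d≡n total all-zero =
      ⊥-elim (ℕ.<⇒≱ (≡.subst (k <_) k+1+d≡n (ℕ.m<m+n k (s≤s z≤n)))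
                    (≡.subst (n ≤_) (≡.sym (ℕ.suc-injective (≡.trans (ℕ.+-comm 1 k) total))) (ℕ.m≤m+n n (n ℕ.+ 0))))
    count-from-zero-prefix n IH (suc d) k (suc L) a k+1+d≡n total all-zero = begin
      count (suc (suc L)) (λ t → singular n (prepend k a t))
        ≡⟨ count-next n k (suc L) a ⟩
      ∑[ i < q ] count (suc L) (λ t → singular n (prepend (suc k) (prepend k a (λ _ → enum i)) t))
        ≡⟨ sum-cong-≋ {q} (λ i → count-from-prefix n IH d (suc k) L (prepend k a (λ _ → enum i)) (≡.trans (≡.sym (ℕ.+-suc k d)) k+1+d≡n)
                                   (≡.trans (≡.sym (ℕ.+-suc k (suc L))) total)) ⟩
      ∑[ i < q ] (q ^ L) ≡⟨ sum-const {q} (q ^ L) ⟩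
      q ^ suc L ∎
      where open ≡.≡-Reasoning

  extension-count : ∀ n → ExtensionCount n
  extension-count = <-rec ExtensionCount λ n IH k L a total k≤n →
    count-from-prefix n IH (n ∸ k) k L a (ℕ.m+[n∸m]≡n k≤n) total

module GoodTuples (F : FiniteField) where
  open FiniteField F hiding (zero)
  open Determinant commRing using (det; det-cong; sign)
  open HankelReduction commRing using (Hankel)
  open Counting F
  open HankelCount F
  open import Algebra.Properties.Semiring.Sum semiring using (sum)

  sumF≈sum : ∀ {m} (f : Fin m → Carrier) → Defs.sumF F f ≈ sum f
  sumF≈sum {zero}  f = refl
  sumF≈sum {suc m} f = +-congˡ (sumF≈sum (λ i → f (suc i)))

  sign≡sign : ∀ j → Defs.sign F j ≡ sign j
  sign≡sign zero    = ≡.refl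
  sign≡sign (suc j) = ≡.cong -_ (sign≡sign j)

  det≈det : ∀ m (M : Defs.Matrix F m) → Defs.det F m M ≈ det m M
  det≈det zero    M = refl
  det≈det (suc m) M = trans (sumF≈sum (λ j → Defs.sign F (toℕ j) * (M zero j * Defs.det F m (minor j)))) (sum-cong-≋ λ j →
    *-cong (reflexive (sign≡sign (toℕ j))) (*-congˡ {x = M zero j} (det≈det m (minor j))))
    where
    open import Algebra.Properties.Semiring.Sum semiring using (sum-cong-≋)
    minor : Fin (suc m) → Defs.Matrix F m
    minor j r c = M (suc r) (punchIn j c)

  hankel≈Hankel : ∀ n s r c → Defs.hankel F n (λ t → s (toℕ t)) r c ≈ Hankel (suc n) s r c
  hankel≈Hankel n s r c = reflexive (≡.cong s (Fin.toℕ-fromℕ< _))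

  module _ {k n : ℕ} (k≤n : k ≤ n) (a : Vector Carrier k) where

    padded : Seq
    padded e with e ℕ.<? k
    ... | yes e<k = a (fromℕ< e<k)
    ... | no _    = 0#

    padded-toℕ : ∀ i → padded (toℕ i) ≈ a i
    padded-toℕ i with toℕ i ℕ.<? k
    ... | yes i<k  = reflexive (≡.cong a (Fin.fromℕ<-toℕ i i<k))
    ... | no i≮k   = ⊥-elim (i≮k (Fin.toℕ<n i))

    good-respects : RespectsPointwise (Defs.Good F k≤n a)
    good-respects x y x≈y (prefix , singular) =
      (λ i → trans (sym (x≈y _)) (prefix i)) ,
      trans (sym (det-cong′ (suc n) (λ r c → x≈y (Defs.hankelIdx F n r c)))) singular
      where
      det-cong′ : ∀ m {M N : Defs.Matrix F m} → (∀ i j → M i j ≈ N i j) → Defs.det F m M ≈ Defs.det F m N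
      det-cong′ m M≈N = trans (det≈det m _) (trans (det-cong m M≈N) (sym (det≈det m _)))

    indicator-good : ∀ s → indicator (Defs.good? F k≤n a (λ t → s (toℕ t))) ≡ indicator (hasPrefix? k padded s) ℕ.* singular n s
    indicator-good s = ≡.trans (indicator-× prefix? (D ≈? 0#))
      (≡.cong₂ ℕ._*_ (indicator-⇔ prefix? (hasPrefix? k padded s) to from)
                     (indicator-⇔ (D ≈? 0#) (singular? n s)
                        (λ det≈0 → trans (sym det-eq) det≈0) (λ det≈0 → trans det-eq det≈0)))
      where
      k≤2n+1 = Defs.k≤2n+1 F k≤n
      prefix? = Fin.all? (λ i → s (toℕ (inject≤ i k≤2n+1)) ≈? a i)
      D = Defs.det F (suc n) (Defs.hankel F n (λ t → s (toℕ t)))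
      to : Defs.PrefixIs F k≤n a (λ t → s (toℕ t)) → HasPrefix k padded s
      to prefix e e<k = ≡.subst (λ i → s i ≈ padded i) (Fin.toℕ-fromℕ< e<k)
        (trans (reflexive (≡.cong s (≡.sym (Fin.toℕ-inject≤ (fromℕ< e<k) k≤2n+1))))
               (trans (prefix (fromℕ< e<k)) (sym (padded-toℕ (fromℕ< e<k)))))
      from : HasPrefix k padded s → Defs.PrefixIs F k≤n a (λ t → s (toℕ t))
      from prefix i = trans (reflexive (≡.cong s (Fin.toℕ-inject≤ i k≤2n+1)))
                            (trans (prefix (toℕ i) (Fin.toℕ<n i)) (padded-toℕ i))
      det-eq : Defs.det F (suc n) (Defs.hankel F n (λ t → s (toℕ t))) ≈ det (suc n) (Hankel (suc n) s)
      det-eq = trans (det≈det (suc n) (Defs.hankel F n (λ t → s (toℕ t)))) (det-cong (suc n) (hankel≈Hankel n s))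

-- Opened only here: inside the modules above they would clash with the ring operations.
open import Data.Nat using (_*_; _^_)

corollary1p7 : (F : FiniteField) (k n : ℕ) (k≤n : k ≤ n)
               (a : Vector (FiniteField.Carrier F) k) →
               countGood F k≤n a ≡ FiniteField.size F ^ (2 * n ∸ k)
corollary1p7 F k n k≤n a = begin
  countGood F k≤n a
    ≡⟨ length-filter-allFuns (suc (2 * n)) (Defs.Good F k≤n a) (Defs.good? F k≤n a) (good-respects k≤n a) ⟩
  count (suc (2 * n)) (λ s → indicator (Defs.good? F k≤n a (λ t → s (toℕ t))))
    ≡⟨ count-cong (suc (2 * n)) (indicator-good k≤n a) ⟩
  count (suc (2 * n)) (λ s → indicator (hasPrefix? k a′ s) * singular n s)
    ≡⟨ ≡.cong (λ l → count l (λ s → indicator (hasPrefix? k a′ s) * singular n s)) (≡.sym total) ⟩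
  count (k ℕ.+ suc L) (λ s → indicator (hasPrefix? k a′ s) * singular n s)
    ≡⟨ count-prefix k (suc L) a′ (singular n) (≡.subst (λ l → DependsOnFirst l (singular n)) (≡.sym total) (singular-local n)) ⟩
  count (suc L) (λ t → singular n (prepend k a′ t))
    ≡⟨ extension-count n k L a′ total k≤n ⟩
  q ^ L ∎
  where
  open Counting F
  open HankelCount F
  open GoodTuples F
  open ≡.≡-Reasoning
  a′ = padded k≤n a
  L = 2 * n ∸ k
  total : k ℕ.+ suc L ≡ suc (2 * n)
  total = ≡.trans (ℕ.+-suc k L) (≡.cong suc (ℕ.m+[n∸m]≡n (ℕ.≤-trans k≤n (ℕ.m≤m+n n (n ℕ.+ 0)))))
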